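{- For every integer $m$, as formal power series in $q$ (equivalently for $|q|<1$), \[\sum_{n=0}^{\infty}\mathcal{D}^0_1(m;n)q^n=\frac{1}{(q^2;q^2)_\infty}\sum_{n=0}^{\infty}(-1)^n q^{3n^2+3n+1+|m|(2n+1)}.\]
   Context: $(a;q)_\infty=\prod_{j\ge0}(1-aq^j)$. An odd Durfee symbol of $n$ is a two-row array $\begin{pmatrix}\alpha_1&\cdots&\alpha_s\\ \beta_1&\cdots&\beta_t\end{pmatrix}_D$ where $D\ge 0$ is an integer, all $\alpha_i,\beta_i$ are odd positive integers, $2D+1\ge\alpha_1\ge\cdots\ge\alpha_s>0$, $2D+1\ge\beta_1\ge\cdots\ge\beta_t>0$, and $n=\sum_i\alpha_i+\sum_i\beta_i+2D^2+2D+1$. Its odd rank is $s-t$. $\mathcal{D}^0_1(m;n)$ denotes the number of odd Durfee symbols of $n$ with odd rank $m$. -}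

module Defs where

open import Data.Nat as ℕ using (ℕ; zero; suc; _≤_; _<_; _≥_; _%_; _≤?_; _<?_; _≥?_)
open import Data.Integer as ℤ using (ℤ; +_; ∣_∣; -1ℤ; 0ℤ; 1ℤ)
open import Data.Nat.ListAction using (sum)
open import Data.List using (List; []; _∷_; length; map; filter; concatMap; applyUpTo; upTo; foldr)
open import Data.List.Relation.Unary.All using (All; all?)
open import Data.List.Relation.Unary.Linked using (Linked; linked?)
open import Data.Product using (_×_; _,_)
open import Relation.Nullary using (Dec; yes; no; does)
open import Relation.Nullary.Decidable using (_×-dec_)
open import Relation.Binary.PropositionalEquality using (_≡_)
open import Data.Bool using (if_then_else_)

IsOdd : ℕ → Set
IsOdd x = x % 2 ≡ 1

record Symbol : Set where
  constructor sym
  field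
    D : ℕ
    α : List ℕ
    β : List ℕ
open Symbol public

ValidRow : ℕ → List ℕ → Set
ValidRow D xs = All IsOdd xs × All (0 <_) xs × All (_≤ 2 ℕ.* D ℕ.+ 1) xs × Linked _≥_ xs

IsOddDurfeeSymbolOf : ℕ → Symbol → Set
IsOddDurfeeSymbolOf n (sym D α β) =
  ValidRow D α × ValidRow D β ×
  (sum α ℕ.+ sum β ℕ.+ (2 ℕ.* D ℕ.* D ℕ.+ 2 ℕ.* D ℕ.+ 1) ≡ n)

oddRank : Symbol → ℤ
oddRank (sym D α β) = (+ length α) ℤ.- (+ length β)

validRow? : ∀ D xs → Dec (ValidRow D xs)
validRow? D xs =
  all? (λ x → x % 2 ℕ.≟ 1) xs ×-dec all? (0 <?_) xs ×-dec
  all? (_≤? 2 ℕ.* D ℕ.+ 1) xs ×-dec linked? _≥?_ xs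

isOddDurfee? : ∀ n S → Dec (IsOddDurfeeSymbolOf n S)
isOddDurfee? n (sym D α β) =
  validRow? D α ×-dec validRow? D β ×-dec
  (sum α ℕ.+ sum β ℕ.+ (2 ℕ.* D ℕ.* D ℕ.+ 2 ℕ.* D ℕ.+ 1) ℕ.≟ n)

listsOfLength : ℕ → List ℕ → List (List ℕ)
listsOfLength zero    vs = [] ∷ []
listsOfLength (suc k) vs = concatMap (λ v → map (v ∷_) (listsOfLength k vs)) vs

listsUpTo : ℕ → List ℕ → List (List ℕ)
listsUpTo L vs = concatMap (λ k → listsOfLength k vs) (upTo (suc L))

-- A finite superset (without repetitions) of all odd Durfee symbols of n:
-- D ≤ n, rows of length ≤ n with entries in {1,…,n}.
candidates : ℕ → List Symbol
candidates n =
  concatMap (λ D → concatMap (λ a → map (sym D a) rows) rows) (upTo (suc n))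
  where
  rows = listsUpTo n (applyUpTo suc n)

D⁰₁ : ℤ → ℕ → ℕ
D⁰₁ m n = length (filter (λ S → isOddDurfee? n S ×-dec (oddRank S ℤ.≟ m)) (candidates n))

PS : Set
PS = ℕ → ℤ

sumℤ : List ℤ → ℤ
sumℤ = foldr ℤ._+_ 0ℤ

_⋆_ : PS → PS → PS
(f ⋆ g) n = sumℤ (map (λ i → f i ℤ.* g (n ℕ.∸ i)) (upTo (suc n)))

onePS : PS
onePS zero    = 1ℤ
onePS (suc _) = 0ℤ

-- 1/(1 - q^d) = Σ_k q^(d k), for d > 0
geomPS : (d : ℕ) → .{{_ : ℕ.NonZero d}} → PS
geomPS d n = if does (n % d ℕ.≟ 0) then 1ℤ else 0ℤ

invPochTrunc : ℕ → PS
invPochTrunc zero    = onePS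
invPochTrunc (suc j) = invPochTrunc j ⋆ geomPS (2 ℕ.* suc j)

-- 1/(q²;q²)_∞ = ∏_{j≥1} 1/(1 - q^(2j)); factors with 2j > n do not
-- affect the coefficient of q^n, so it is the coefficient of the product up to j = n.
invPoch : PS
invPoch n = invPochTrunc n n

-- Σ_{k≥0} (-1)^k q^(3k²+3k+1+|m|(2k+1)); exponent ≥ k, so k ≤ n suffices
expo : ℤ → ℕ → ℕ
expo m k = 3 ℕ.* k ℕ.* k ℕ.+ 3 ℕ.* k ℕ.+ 1 ℕ.+ ∣ m ∣ ℕ.* (2 ℕ.* k ℕ.+ 1)

thetaPS : ℤ → PS
thetaPS m n = sumℤ (map (λ k → if does (expo m k ℕ.≟ n) then -1ℤ ℤ.^ k else 0ℤ) (upTo (suc n)))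

genD : ℤ → PS
genD m n = + D⁰₁ m n

-- All series are coefficient functions ℕ → ℕ; ℤ enters only at the end.
-- 1. A row of an odd Durfee symbol with s odd parts ≤ 2D+1 contributes
--    qˢ·[D+s choose s]_{q²} (`Rows`), so for M = |m| the left side is
--    q^(M+1)·durfeeSeries M, a sum over D and t of q^(2D(D+1)+2t) times two
--    Gaussian polynomials (`SymbolCounting`); ranks m and -m give the same count.
-- 2. Decomposing partitions along their D × (D+1) Durfee rectangle
--    (`DurfeeRectangles`) gives, in the variable q², durfeeSeries M = the series
--    of partitions whose largest part exceeds the number of parts by at most
--    M+1, and the remaining partitions contribute q^(2M+6) times the same series
--    for M+3 (`PartitionIdentities`).  Hence L_M + q^(2M+3) L_(M+3) = q^(M+1)/(q²;q²)_∞.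
-- 3. The right side satisfies the same recursion (`RightHandSide`), and the two
--    sides are identified by induction on the exponent (`Telescoping`).
module Submission where

open import Data.Nat
open import Data.Nat.Properties
open import Data.Nat.DivMod using ([m+kn]%n≡m%n; [m+n]%n≡m%n; m<n⇒m%n≡m)
open import Data.Nat.ListAction using (sum)
open import Data.Nat.Tactic.RingSolver using (solve-∀)
import Data.Integer.Tactic.RingSolver as ZR
import Data.Integer
open import Data.Integer as ℤ using (ℤ; ∣_∣; 0ℤ; 1ℤ; -1ℤ)
import Data.Integer.Properties as ℤP
open import Data.Bool using (Bool; true; false; _∧_; if_then_else_)
open import Data.Bool.Properties using (T-≡)
open import Data.List using (List; []; _∷_; _++_; map; concatMap; applyUpTo; upTo; length; filter)
open import Data.List.Relation.Unary.All using (all?)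
open import Data.List.Relation.Unary.Linked using (linked?)
open import Data.Product using (Σ; _,_; _×_)
open import Data.Sum using (_⊎_; inj₁; inj₂)
open import Data.Empty using (⊥-elim)
open import Function.Bundles using (Equivalence)
open import Relation.Nullary using (does; Dec; yes; no)
open import Relation.Nullary.Decidable using (_×-dec_)
open import Relation.Binary.PropositionalEquality
open ≡-Reasoning
open import Defs hiding (sym; D; α; β)
open Defs using () renaming (sym to mkS)
-- Everything is stated coefficientwise: an identity of
-- series F = G is the family of equations F n ≡ G n.
module PowerSeries where

  Series : Set
  Series = ℕ → ℕ

  infixl 6 _⊕_
  _⊕_ : Series → Series → Series
  (f ⊕ g) n = f n + g n

  𝟘 : Series
  𝟘 _ = 0

  δ : Series
  δ zero    = 1
  δ (suc _) = 0

  shift : ℕ → Series → Series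
  shift zero    f n       = f n
  shift (suc k) f zero    = 0
  shift (suc k) f (suc n) = shift k f n

  σ : ℕ → (ℕ → ℕ) → ℕ
  σ zero    f = 0
  σ (suc n) f = f 0 + σ n (λ i → f (suc i))

  sumSeries : ℕ → (ℕ → Series) → Series
  sumSeries n F x = σ n (λ i → F i x)

  conv : Series → Series → Series
  conv f g n = σ (suc n) (λ i → f i * g (n ∸ i))

  -- `guard c x v` is v when c ≤ x and 0 otherwise; it records the range
  -- condition of a term in a double sum that is being reindexed.
  guard : ℕ → ℕ → ℕ → ℕ
  guard zero    x       v = v
  guard (suc c) zero    v = 0
  guard (suc c) (suc x) v = guard c x v

  +-interchange : ∀ a b c d → (a + b) + (c + d) ≡ (a + c) + (b + d)
  +-interchange = solve-∀

  n≤2*n : ∀ n → n ≤ 2 * n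
  n≤2*n n = m≤m+n n (n + 0)

  data Split (k n : ℕ) : Set where
    lt : n < k → Split k n
    ge : ∀ n' → n ≡ k + n' → Split k n

  split : ∀ k n → Split k n
  split zero    n    = ge n refl
  split (suc k) zero = lt (s≤s z≤n)
  split (suc k) (suc n) with split k n
  ... | lt p    = lt (s≤s p)
  ... | ge n' e = ge n' (cong suc e)

  σ-cong< : ∀ n {f g : ℕ → ℕ} → (∀ i → i < n → f i ≡ g i) → σ n f ≡ σ n g
  σ-cong< zero    e = refl
  σ-cong< (suc n) e = cong₂ _+_ (e 0 (s≤s z≤n)) (σ-cong< n (λ i p → e (suc i) (s≤s p)))

  σ-cong : ∀ n {f g : ℕ → ℕ} → (∀ i → f i ≡ g i) → σ n f ≡ σ n g
  σ-cong n e = σ-cong< n (λ i _ → e i)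

  σ-zero : ∀ n {f : ℕ → ℕ} → (∀ i → i < n → f i ≡ 0) → σ n f ≡ 0
  σ-zero zero    e = refl
  σ-zero (suc n) e = cong₂ _+_ (e 0 (s≤s z≤n)) (σ-zero n (λ i p → e (suc i) (s≤s p)))

  σ-+ : ∀ n f g → σ n (λ i → f i + g i) ≡ σ n f + σ n g
  σ-+ zero    f g = refl
  σ-+ (suc n) f g = trans (cong (f 0 + g 0 +_) (σ-+ n _ _)) (+-interchange (f 0) (g 0) _ _)

  σ-*ˡ : ∀ n c f → σ n (λ i → c * f i) ≡ c * σ n f
  σ-*ˡ zero    c f = sym (*-zeroʳ c)
  σ-*ˡ (suc n) c f = trans (cong (c * f 0 +_) (σ-*ˡ n c _)) (sym (*-distribˡ-+ c (f 0) _))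

  σ-*ʳ : ∀ n c f → σ n (λ i → f i * c) ≡ σ n f * c
  σ-*ʳ n c f = trans (σ-cong n (λ i → *-comm (f i) c)) (trans (σ-*ˡ n c f) (*-comm c _))

  σ-split : ∀ a b f → σ (a + b) f ≡ σ a f + σ b (λ i → f (a + i))
  σ-split zero    b f = refl
  σ-split (suc a) b f = trans (cong (f 0 +_) (σ-split a b _)) (sym (+-assoc (f 0) _ _))

  σ-last : ∀ n f → σ (suc n) f ≡ σ n f + f n
  σ-last n f = begin
    σ (suc n) f                        ≡⟨ cong (λ x → σ x f) (+-comm 1 n) ⟩
    σ (n + 1) f                        ≡⟨ σ-split n 1 f ⟩
    σ n f + (f (n + 0) + 0)            ≡⟨ cong (σ n f +_) (trans (+-identityʳ _) (cong f (+-identityʳ n))) ⟩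
    σ n f + f n                        ∎

  σ-swap : ∀ n m (F : ℕ → ℕ → ℕ) → σ n (λ i → σ m (λ j → F i j)) ≡ σ m (λ j → σ n (λ i → F i j))
  σ-swap zero    m F = sym (σ-zero m (λ _ _ → refl))
  σ-swap (suc n) m F = begin
    σ m (F 0) + σ n (λ i → σ m (F (suc i)))
      ≡⟨ cong (σ m (F 0) +_) (σ-swap n m (λ i → F (suc i))) ⟩
    σ m (F 0) + σ m (λ j → σ n (λ i → F (suc i) j))
      ≡⟨ sym (σ-+ m _ _) ⟩
    σ m (λ j → F 0 j + σ n (λ i → F (suc i) j)) ∎

  σ-truncate : ∀ n m f → n ≤ m → (∀ i → n ≤ i → f i ≡ 0) → σ m f ≡ σ n f
  σ-truncate n m f le z = begin
    σ m f                               ≡⟨ cong (λ x → σ x f) (sym (m+[n∸m]≡n le)) ⟩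
    σ (n + (m ∸ n)) f                   ≡⟨ σ-split n (m ∸ n) f ⟩
    σ n f + σ (m ∸ n) (λ i → f (n + i)) ≡⟨ cong (σ n f +_) (σ-zero (m ∸ n) (λ i _ → z (n + i) (m≤m+n n i))) ⟩
    σ n f + 0                           ≡⟨ +-identityʳ _ ⟩
    σ n f                               ∎

  σ-truncate₂ : ∀ B n m f → (∀ i → B ≤ i → f i ≡ 0) → B ≤ n → B ≤ m → σ n f ≡ σ m f
  σ-truncate₂ B n m f z p q = trans (σ-truncate B n f p z) (sym (σ-truncate B m f q z))

  σ-reverse : ∀ n f → σ n f ≡ σ n (λ i → f (n ∸ suc i))
  σ-reverse zero    f = refl
  σ-reverse (suc n) f = begin
    f 0 + σ n (λ i → f (suc i))
      ≡⟨ cong (f 0 +_) (σ-reverse n _) ⟩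
    f 0 + σ n (λ i → f (suc (n ∸ suc i)))
      ≡⟨ +-comm (f 0) _ ⟩
    σ n (λ i → f (suc (n ∸ suc i))) + f 0
      ≡⟨ cong₂ _+_ (σ-cong< n (λ i p → cong f (sym (+-∸-assoc 1 p)))) (cong f (sym (n∸n≡0 n))) ⟩
    σ n (λ i → f (suc n ∸ suc i)) + f (suc n ∸ suc n)
      ≡⟨ sym (σ-last n _) ⟩
    σ (suc n) (λ i → f (suc n ∸ suc i)) ∎

  shift-cong : ∀ k {f g : Series} → (∀ n → f n ≡ g n) → ∀ n → shift k f n ≡ shift k g n
  shift-cong zero    e n       = e n
  shift-cong (suc k) e zero    = refl
  shift-cong (suc k) e (suc n) = shift-cong k e n

  shift-≡ : ∀ {a b} f n → a ≡ b → shift a f n ≡ shift b f n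
  shift-≡ f n e = cong (λ x → shift x f n) e

  shift-⊕ : ∀ k f g n → shift k (f ⊕ g) n ≡ shift k f n + shift k g n
  shift-⊕ zero    f g n       = refl
  shift-⊕ (suc k) f g zero    = refl
  shift-⊕ (suc k) f g (suc n) = shift-⊕ k f g n

  shift-shift : ∀ a b f n → shift a (shift b f) n ≡ shift (a + b) f n
  shift-shift zero    b f n       = refl
  shift-shift (suc a) b f zero    = refl
  shift-shift (suc a) b f (suc n) = shift-shift a b f n

  shift-shift≡ : ∀ a b c f n → a + b ≡ c → shift a (shift b f) n ≡ shift c f n
  shift-shift≡ a b c f n e = trans (shift-shift a b f n) (shift-≡ f n e)

  shift-𝟘 : ∀ k n → shift k 𝟘 n ≡ 0
  shift-𝟘 zero    n       = refl
  shift-𝟘 (suc k) zero    = refl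
  shift-𝟘 (suc k) (suc n) = shift-𝟘 k n

  shift-< : ∀ k f n → n < k → shift k f n ≡ 0
  shift-< (suc k) f zero    p       = refl
  shift-< (suc k) f (suc n) (s≤s p) = shift-< k f n p

  shift-+ : ∀ k f n → shift k f (k + n) ≡ f n
  shift-+ zero    f n = refl
  shift-+ (suc k) f n = shift-+ k f n

  shift-cong-at : ∀ k f g n → (k ≤ n → f (n ∸ k) ≡ g (n ∸ k)) → shift k f n ≡ shift k g n
  shift-cong-at k f g n h with split k n
  ... | lt p       = trans (shift-< k f n p) (sym (shift-< k g n p))
  ... | ge n' refl = begin
    shift k f (k + n')  ≡⟨ shift-+ k f n' ⟩
    f n'                ≡⟨ subst (λ z → f z ≡ g z) (m+n∸m≡n k n') (h (m≤m+n k n')) ⟩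
    g n'                ≡⟨ sym (shift-+ k g n') ⟩
    shift k g (k + n')  ∎

  shift-σ : ∀ k m F n → shift k (sumSeries m F) n ≡ σ m (λ i → shift k (F i) n)
  shift-σ zero    m F n       = refl
  shift-σ (suc k) m F zero    = sym (σ-zero m (λ _ _ → refl))
  shift-σ (suc k) m F (suc n) = shift-σ k m F n

  guard-≤ : ∀ c x v → c ≤ x → guard c x v ≡ v
  guard-≤ zero    x       v p       = refl
  guard-≤ (suc c) (suc x) v (s≤s p) = guard-≤ c x v p

  guard-> : ∀ c x v → x < c → guard c x v ≡ 0
  guard-> (suc c) zero    v p       = refl
  guard-> (suc c) (suc x) v (s≤s p) = guard-> c x v p

  guard-+ : ∀ c k v → guard c (c + k) v ≡ v
  guard-+ zero    k v = refl
  guard-+ (suc c) k v = guard-+ c k v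

  guard-0 : ∀ c x → guard c x 0 ≡ 0
  guard-0 zero    x       = refl
  guard-0 (suc c) zero    = refl
  guard-0 (suc c) (suc x) = guard-0 c x

  guard-comm : ∀ c x d y v → guard c x (guard d y v) ≡ guard d y (guard c x v)
  guard-comm zero    x       d y v = refl
  guard-comm (suc c) zero    d y v = sym (guard-0 d y)
  guard-comm (suc c) (suc x) d y v = guard-comm c x d y v

  guard-split : ∀ a X v → v ≡ guard a X v + guard (suc X) a v
  guard-split zero    X       v = sym (+-identityʳ v)
  guard-split (suc a) zero    v = refl
  guard-split (suc a) (suc X) v = guard-split a X v

  guard-shift : ∀ c l a v → guard (c + l) a v ≡ guard c a (guard l (a ∸ c) v)
  guard-shift zero    l a       v = refl
  guard-shift (suc c) l zero    v = refl
  guard-shift (suc c) l (suc a) v = guard-shift c l a v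

  guard-as-shift : ∀ c n (F : Series) → guard c n (F (n ∸ c)) ≡ shift c F n
  guard-as-shift c n F with split c n
  ... | lt p       = trans (guard-> c n _ p) (sym (shift-< c F n p))
  ... | ge n' refl = trans (guard-+ c n' _) (trans (cong F (m+n∸m≡n c n')) (sym (shift-+ c F n')))

  shift-guard : ∀ k c x f n → shift k (λ m → guard c x (f m)) n ≡ guard c x (shift k f n)
  shift-guard zero    c x f n       = refl
  shift-guard (suc k) c x f zero    = sym (guard-0 c x)
  shift-guard (suc k) c x f (suc n) = shift-guard k c x f n

  σ-guard-out : ∀ n c x f → σ n (λ i → guard c x (f i)) ≡ guard c x (σ n f)
  σ-guard-out n zero    x       f = refl
  σ-guard-out n (suc c) zero    f = σ-zero n (λ _ _ → refl)
  σ-guard-out n (suc c) (suc x) f = σ-guard-out n c x f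

  σ-guard : ∀ c a (h : ℕ → ℕ) → σ (suc a) (λ x → guard c x (h x)) ≡ guard c a (σ (suc (a ∸ c)) (λ k → h (c + k)))
  σ-guard c a h with split c a
  ... | lt p = trans (σ-zero (suc a) (λ x q → guard-> c x (h x) (≤-<-trans (≤-pred q) p)))
                     (sym (guard-> c a (σ (suc (a ∸ c)) (λ k → h (c + k))) p))
  ... | ge a' refl = begin
    σ (suc (c + a')) (λ x → guard c x (h x))
      ≡⟨ cong (λ y → σ y (λ x → guard c x (h x))) (sym (+-suc c a')) ⟩
    σ (c + suc a') (λ x → guard c x (h x))
      ≡⟨ σ-split c (suc a') (λ x → guard c x (h x)) ⟩
    σ c (λ x → guard c x (h x)) + σ (suc a') (λ k → guard c (c + k) (h (c + k)))
      ≡⟨ cong₂ _+_ (σ-zero c (λ x q → guard-> c x (h x) q)) (σ-cong (suc a') (λ k → guard-+ c k (h (c + k)))) ⟩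
    σ (suc a') (λ k → h (c + k))
      ≡⟨ cong (λ y → σ (suc y) (λ k → h (c + k))) (sym (m+n∸m≡n c a')) ⟩
    σ (suc (c + a' ∸ c)) (λ k → h (c + k))
      ≡⟨ sym (guard-+ c a' (σ (suc (c + a' ∸ c)) (λ k → h (c + k)))) ⟩
    guard c (c + a') (σ (suc (c + a' ∸ c)) (λ k → h (c + k))) ∎

  σ-guard-extend : ∀ l' l (X : ℕ → ℕ) → l' ≤ l → σ (suc l) (λ D → guard D l' (X D)) ≡ σ (suc l') X
  σ-guard-extend l' l X le = begin
    σ (suc l) (λ D → guard D l' (X D))
      ≡⟨ σ-truncate (suc l') (suc l) (λ D → guard D l' (X D)) (s≤s le) (λ i p → guard-> i l' (X i) p) ⟩
    σ (suc l') (λ D → guard D l' (X D))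
      ≡⟨ σ-cong< (suc l') {g = X} (λ i p → guard-≤ i l' (X i) (≤-pred p)) ⟩
    σ (suc l') X ∎

  σ-triangle : ∀ N (F : ℕ → ℕ → ℕ) → σ (suc N) (λ l → σ (suc l) (λ D → F D (l ∸ D))) ≡ σ (suc N) (λ D → σ (suc (N ∸ D)) (λ t → F D t))
  σ-triangle N F = begin
    σ (suc N) (λ l → σ (suc l) (λ D → F D (l ∸ D)))
      ≡⟨ σ-cong< (suc N) (λ l p → sym (σ-guard-extend l N (λ D → F D (l ∸ D)) (≤-pred p))) ⟩
    σ (suc N) (λ l → σ (suc N) (λ D → guard D l (F D (l ∸ D))))
      ≡⟨ σ-swap (suc N) (suc N) (λ l D → guard D l (F D (l ∸ D))) ⟩
    σ (suc N) (λ D → σ (suc N) (λ l → guard D l (F D (l ∸ D))))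
      ≡⟨ σ-cong< (suc N) (λ D p → trans (σ-guard D N (λ l → F D (l ∸ D)))
            (trans (guard-≤ D N _ (≤-pred p)) (σ-cong (suc (N ∸ D)) (λ t → cong (F D) (m+n∸m≡n D t))))) ⟩
    σ (suc N) (λ D → σ (suc (N ∸ D)) (λ t → F D t)) ∎

  σ-guard-extend′ : ∀ B X (h : ℕ → ℕ) → (∀ a → suc B ≤ a → h a ≡ 0) → σ (suc B) (λ a → guard a X (h a)) ≡ σ (suc X) h
  σ-guard-extend′ B X h z with ≤-total X B
  ... | inj₁ le = σ-guard-extend X B h le
  ... | inj₂ le = trans (σ-cong< (suc B) (λ a p → guard-≤ a X (h a) (≤-trans (≤-pred p) le)))
                        (sym (σ-truncate (suc B) (suc X) h (s≤s le) z))

  conv-cong : ∀ {f f' g g' : Series} → (∀ n → f n ≡ f' n) → (∀ n → g n ≡ g' n) → ∀ n → conv f g n ≡ conv f' g' n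
  conv-cong ef eg n = σ-cong (suc n) (λ i → cong₂ _*_ (ef i) (eg (n ∸ i)))

  conv-cong≤ : ∀ N (f f' g g' : Series) → (∀ i → i ≤ N → f i ≡ f' i) → (∀ i → i ≤ N → g i ≡ g' i) → conv f g N ≡ conv f' g' N
  conv-cong≤ N f f' g g' ef eg = σ-cong< (suc N) (λ i p → cong₂ _*_ (ef i (≤-pred p)) (eg (N ∸ i) (m∸n≤m N i)))

  conv-⊕ʳ : ∀ f g h n → conv h (f ⊕ g) n ≡ conv h f n + conv h g n
  conv-⊕ʳ f g h n = trans (σ-cong (suc n) (λ i → *-distribˡ-+ (h i) (f (n ∸ i)) (g (n ∸ i))))
                          (σ-+ (suc n) (λ i → h i * f (n ∸ i)) (λ i → h i * g (n ∸ i)))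

  conv-sumSeriesˡ : ∀ m F g n → conv (sumSeries m F) g n ≡ σ m (λ j → conv (F j) g n)
  conv-sumSeriesˡ m F g n = trans (σ-cong (suc n) (λ i → sym (σ-*ʳ m (g (n ∸ i)) (λ j → F j i))))
                                  (σ-swap (suc n) m (λ i j → F j i * g (n ∸ i)))

  conv-sumSeriesʳ : ∀ m F g n → conv g (sumSeries m F) n ≡ σ m (λ j → conv g (F j) n)
  conv-sumSeriesʳ m F g n = trans (σ-cong (suc n) (λ i → sym (σ-*ˡ m (g i) (λ j → F j (n ∸ i)))))
                                  (σ-swap (suc n) m (λ i j → g i * F j (n ∸ i)))

  conv-comm : ∀ f g n → conv f g n ≡ conv g f n
  conv-comm f g n = trans (σ-reverse (suc n) (λ i → f i * g (n ∸ i)))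
    (σ-cong< (suc n) {f = λ i → f (n ∸ i) * g (n ∸ (n ∸ i))} {g = λ i → g i * f (n ∸ i)}
      (λ i p → trans (*-comm (f (n ∸ i)) _) (cong (λ x → g x * f (n ∸ i)) (m∸[m∸n]≡n (≤-pred p)))))

  conv-𝟘 : ∀ g n → conv 𝟘 g n ≡ 0
  conv-𝟘 g n = σ-zero (suc n) (λ _ _ → refl)

  conv-δˡ : ∀ g n → conv δ g n ≡ g n
  conv-δˡ g n = trans (cong (_+ _) (+-identityʳ (g n))) (trans (cong (g n +_) (σ-zero n (λ i _ → refl))) (+-identityʳ _))

  conv-δʳ : ∀ g n → conv g δ n ≡ g n
  conv-δʳ g n = trans (conv-comm g δ n) (conv-δˡ g n)

  conv-shiftˡ : ∀ k f g n → conv (shift k f) g n ≡ shift k (conv f g) n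
  conv-shiftˡ k f g n with split k n
  ... | lt p = trans (σ-zero (suc n) (λ i q → cong (_* g (n ∸ i)) (shift-< k f i (≤-<-trans (≤-pred q) p))))
                     (sym (shift-< k _ n p))
  ... | ge n' refl = begin
    σ (suc (k + n')) (λ i → shift k f i * g (k + n' ∸ i))
      ≡⟨ cong (λ x → σ x (λ i → shift k f i * g (k + n' ∸ i))) (sym (+-suc k n')) ⟩
    σ (k + suc n') (λ i → shift k f i * g (k + n' ∸ i))
      ≡⟨ σ-split k (suc n') _ ⟩
    σ k (λ i → shift k f i * g (k + n' ∸ i)) + σ (suc n') (λ i → shift k f (k + i) * g (k + n' ∸ (k + i)))
      ≡⟨ cong₂ _+_ (σ-zero k (λ i p → cong (_* g (k + n' ∸ i)) (shift-< k f i p)))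
                   (σ-cong (suc n') (λ i → cong₂ _*_ (shift-+ k f i) (cong g ([m+n]∸[m+o]≡n∸o k n' i)))) ⟩
    conv f g n'
      ≡⟨ sym (shift-+ k _ n') ⟩
    shift k (conv f g) (k + n') ∎

  conv-shiftʳ : ∀ k f g n → conv f (shift k g) n ≡ shift k (conv f g) n
  conv-shiftʳ k f g n = trans (conv-comm f (shift k g) n) (trans (conv-shiftˡ k g f n) (shift-cong k (conv-comm g f) n))

  conv-shift² : ∀ a b f g x → conv (shift a f) (shift b g) x ≡ shift (a + b) (conv f g) x
  conv-shift² a b f g x = trans (conv-shiftˡ a f (shift b g) x) (trans (shift-cong a (conv-shiftʳ b f g) x) (shift-shift a b (conv f g) x))

-- Gaussian polynomials in q².  `gauss D s` is the generating function of
-- partitions into at most s parts, each at most D, where a partition of k is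
-- weighted q^(2k); i.e. it is the q²-binomial coefficient [D+s choose s].
-- It is defined by the recursion "at most s parts, or exactly s+1 parts"
-- (in the latter case subtract 1 from every part).
module Gaussian where

  open PowerSeries

  gauss : ℕ → ℕ → Series
  gauss D       zero    = δ
  gauss zero    (suc s) = δ
  gauss (suc D) (suc s) = gauss (suc D) s ⊕ shift (2 * suc s) (gauss D (suc s))

  -- partitions into exactly k parts, each at most D
  exactly : ℕ → ℕ → Series
  exactly zero    zero    = δ
  exactly zero    (suc k) = 𝟘
  exactly (suc D) k       = shift (2 * k) (gauss D k)

  gauss-zero : ∀ s n → gauss 0 s n ≡ δ n
  gauss-zero zero    n = refl
  gauss-zero (suc s) n = refl

  gauss-suc : ∀ D s n → gauss D (suc s) n ≡ gauss D s n + exactly D (suc s) n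
  gauss-suc zero    zero    n = sym (+-identityʳ _)
  gauss-suc zero    (suc s) n = sym (+-identityʳ _)
  gauss-suc (suc D) s       n = refl

  gauss-σ-exactly : ∀ D s n → gauss D s n ≡ σ (suc s) (λ k → exactly D k n)
  gauss-σ-exactly zero    zero    n = sym (+-identityʳ _)
  gauss-σ-exactly (suc D) zero    n = sym (+-identityʳ _)
  gauss-σ-exactly D       (suc s) n = begin
    gauss D (suc s) n                                     ≡⟨ gauss-suc D s n ⟩
    gauss D s n + exactly D (suc s) n                     ≡⟨ cong (_+ exactly D (suc s) n) (gauss-σ-exactly D s n) ⟩
    σ (suc s) (λ k → exactly D k n) + exactly D (suc s) n ≡⟨ sym (σ-last (suc s) (λ k → exactly D k n)) ⟩
    σ (suc (suc s)) (λ k → exactly D k n)                 ∎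

  private
    2+2*suc : ∀ s → 2 + 2 * suc s ≡ 2 * suc (suc s)
    2+2*suc = solve-∀
    2*suc-comm : ∀ s D → 2 * suc (suc s) + 2 * suc D ≡ 2 * suc (suc D) + 2 * suc s
    2*suc-comm = solve-∀

  -- The conjugate recursion: either no part equals D+1, or remove one part D+1.
  -- (In terms of the transposed diagram this is the defining recursion again.)
  gauss-conjugate : ∀ D s n → gauss (suc D) (suc s) n ≡ gauss D (suc s) n + shift (2 * suc D) (gauss (suc D) s) n
  gauss-conjugate zero zero n = refl
  gauss-conjugate zero (suc s) n = begin
    gauss 1 (suc s) n + shift (2 * suc (suc s)) δ n
      ≡⟨ cong (_+ shift (2 * suc (suc s)) δ n) (gauss-conjugate zero s n) ⟩
    (δ n + shift 2 (gauss 1 s) n) + shift (2 * suc (suc s)) δ n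
      ≡⟨ +-assoc (δ n) _ _ ⟩
    δ n + (shift 2 (gauss 1 s) n + shift (2 * suc (suc s)) δ n)
      ≡⟨ cong (λ x → δ n + (shift 2 (gauss 1 s) n + x)) (sym (shift-shift≡ 2 (2 * suc s) _ δ n (2+2*suc s))) ⟩
    δ n + (shift 2 (gauss 1 s) n + shift 2 (shift (2 * suc s) δ) n)
      ≡⟨ cong (δ n +_) (sym (shift-⊕ 2 (gauss 1 s) _ n)) ⟩
    δ n + shift 2 (gauss 1 (suc s)) n ∎
  gauss-conjugate (suc D) zero n = begin
    δ n + shift 2 (gauss (suc D) 1) n
      ≡⟨ cong (δ n +_) (shift-cong 2 (gauss-conjugate D zero) n) ⟩
    δ n + shift 2 (gauss D 1 ⊕ shift (2 * suc D) δ) n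
      ≡⟨ cong (δ n +_) (shift-⊕ 2 (gauss D 1) _ n) ⟩
    δ n + (shift 2 (gauss D 1) n + shift 2 (shift (2 * suc D) δ) n)
      ≡⟨ sym (+-assoc (δ n) _ _) ⟩
    (δ n + shift 2 (gauss D 1) n) + shift 2 (shift (2 * suc D) δ) n
      ≡⟨ cong ((δ n + shift 2 (gauss D 1) n) +_) (shift-shift≡ 2 (2 * suc D) _ δ n (2+2*suc D)) ⟩
    gauss (suc D) 1 n + shift (2 * suc (suc D)) δ n ∎
  gauss-conjugate (suc D) (suc s) n = begin
    gauss (suc (suc D)) (suc s) n + shift (2 * suc (suc s)) (gauss (suc D) (suc (suc s))) n
      ≡⟨ cong₂ _+_ (gauss-conjugate (suc D) s n)
                   (trans (shift-cong (2 * suc (suc s)) (gauss-conjugate D (suc s)) n) (shift-⊕ (2 * suc (suc s)) _ _ n)) ⟩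
    (gauss (suc D) (suc s) n + shift (2 * suc (suc D)) (gauss (suc (suc D)) s) n)
      + (shift (2 * suc (suc s)) (gauss D (suc (suc s))) n + shift (2 * suc (suc s)) (shift (2 * suc D) (gauss (suc D) (suc s))) n)
      ≡⟨ cong (λ x → (gauss (suc D) (suc s) n + shift (2 * suc (suc D)) (gauss (suc (suc D)) s) n)
                   + (shift (2 * suc (suc s)) (gauss D (suc (suc s))) n + x))
             (trans (shift-shift≡ (2 * suc (suc s)) (2 * suc D) _ (gauss (suc D) (suc s)) n (2*suc-comm s D))
                    (sym (shift-shift (2 * suc (suc D)) (2 * suc s) _ n))) ⟩
    (gauss (suc D) (suc s) n + shift (2 * suc (suc D)) (gauss (suc (suc D)) s) n)
      + (shift (2 * suc (suc s)) (gauss D (suc (suc s))) n + shift (2 * suc (suc D)) (shift (2 * suc s) (gauss (suc D) (suc s))) n)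
      ≡⟨ +-interchange (gauss (suc D) (suc s) n) _ _ _ ⟩
    (gauss (suc D) (suc s) n + shift (2 * suc (suc s)) (gauss D (suc (suc s))) n)
      + (shift (2 * suc (suc D)) (gauss (suc (suc D)) s) n + shift (2 * suc (suc D)) (shift (2 * suc s) (gauss (suc D) (suc s))) n)
      ≡⟨ cong (gauss (suc D) (suc (suc s)) n +_) (sym (shift-⊕ (2 * suc (suc D)) _ _ n)) ⟩
    gauss (suc D) (suc (suc s)) n + shift (2 * suc (suc D)) (gauss (suc (suc D)) (suc s)) n ∎

  -- sorting by the largest part c of a partition into at most s+1 parts ≤ D
  gauss-largest : ∀ D s n → gauss D (suc s) n ≡ σ (suc D) (λ c → shift (2 * c) (gauss c s) n)
  gauss-largest zero    s n = sym (trans (+-identityʳ _) (gauss-zero s n))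
  gauss-largest (suc D) s n = begin
    gauss (suc D) (suc s) n
      ≡⟨ gauss-conjugate D s n ⟩
    gauss D (suc s) n + shift (2 * suc D) (gauss (suc D) s) n
      ≡⟨ cong (_+ shift (2 * suc D) (gauss (suc D) s) n) (gauss-largest D s n) ⟩
    σ (suc D) (λ c → shift (2 * c) (gauss c s) n) + shift (2 * suc D) (gauss (suc D) s) n
      ≡⟨ sym (σ-last (suc D) (λ c → shift (2 * c) (gauss c s) n)) ⟩
    σ (suc (suc D)) (λ c → shift (2 * c) (gauss c s) n) ∎

  -- Bounds that cannot bind at the coefficient of qʷ: a partition of weight w
  -- has at most w parts, and has no part D + 1 if w < 2(D + 1).

  gauss-stable+ : ∀ D d w → gauss D (w + d) w ≡ gauss D w w
  gauss-stable+ D zero w = cong (λ z → gauss D z w) (+-identityʳ w)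
  gauss-stable+ D (suc d) w = begin
    gauss D (w + suc d) w
      ≡⟨ cong (λ z → gauss D z w) (+-suc w d) ⟩
    gauss D (suc (w + d)) w
      ≡⟨ gauss-suc D (w + d) w ⟩
    gauss D (w + d) w + exactly D (suc (w + d)) w
      ≡⟨ cong (λ z → gauss D (w + d) w + z) (noLongPartition D) ⟩
    gauss D (w + d) w + 0
      ≡⟨ +-identityʳ _ ⟩
    gauss D (w + d) w
      ≡⟨ gauss-stable+ D d w ⟩
    gauss D w w ∎
    where
    noLongPartition : ∀ D → exactly D (suc (w + d)) w ≡ 0
    noLongPartition zero = refl
    noLongPartition (suc D') = shift-< (2 * suc (w + d)) _ w (≤-trans (s≤s (m≤m+n w d)) (n≤2*n (suc (w + d))))

  gauss-stable : ∀ D K w → w ≤ K → gauss D K w ≡ gauss D w w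
  gauss-stable D K w le = trans (cong (λ z → gauss D z w) (sym (m+[n∸m]≡n le))) (gauss-stable+ D (K ∸ w) w)

  gauss-stableᴰ : ∀ D s w → w < 2 * suc D → gauss (suc D) s w ≡ gauss D s w
  gauss-stableᴰ D zero w p = refl
  gauss-stableᴰ D (suc s) w p = trans (gauss-conjugate D s w) (trans (cong (λ z → gauss D (suc s) w + z) (shift-< (2 * suc D) _ w p)) (+-identityʳ _))

-- A nonempty partition with largest part a
-- and l parts has a unique D such that its first D parts are ≥ D+1 and its
-- (D+1)-st part is ≤ D+1.  Removing the D × (D+1) rectangle leaves, to its
-- right, a - (D+1) columns of height ≤ D, and below it, l - D rows of length
-- ≤ D+1.  We take this decomposition as the definition of `durfeeCount a l`
-- and prove that it counts the partitions with exactly l parts and largest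
-- part exactly a (`countsParts`).  All weights are doubled (q² per cell).
module DurfeeRectangles where

  open PowerSeries
  open Gaussian

  -- D × (D+1) rectangle, k extra columns of height ≤ D, t extra rows of length ≤ D+1
  block : ℕ → ℕ → ℕ → Series
  block D k t = shift (2 * (D * suc D)) (conv (exactly D k) (exactly (suc D) t))

  durfeeCount : ℕ → ℕ → Series
  durfeeCount a l n = σ (suc l) (λ D → guard (suc D) a (block D (a ∸ suc D) (l ∸ D) n))

  blocksWithin : ℕ → ℕ → ℕ → Series
  blocksWithin a l D m = σ (suc (a ∸ suc D)) (λ k' → σ (suc (l ∸ D)) (λ t' → block D k' t' m))

  durfeeCount-zero : ∀ l n → durfeeCount 0 l n ≡ 0
  durfeeCount-zero l n = σ-zero (suc l) (λ _ _ → refl)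

  conv-gauss-exactly : ∀ D k t m → conv (gauss D k) (gauss (suc D) t) m
                                 ≡ σ (suc k) (λ k' → σ (suc t) (λ t' → conv (exactly D k') (exactly (suc D) t') m))
  conv-gauss-exactly D k t m = begin
    conv (gauss D k) (gauss (suc D) t) m
      ≡⟨ conv-cong (gauss-σ-exactly D k) (gauss-σ-exactly (suc D) t) m ⟩
    conv (sumSeries (suc k) (exactly D)) (sumSeries (suc t) (exactly (suc D))) m
      ≡⟨ conv-sumSeriesˡ (suc k) (exactly D) (sumSeries (suc t) (exactly (suc D))) m ⟩
    σ (suc k) (λ k' → conv (exactly D k') (sumSeries (suc t) (exactly (suc D))) m)
      ≡⟨ σ-cong (suc k) (λ k' → conv-sumSeriesʳ (suc t) (exactly (suc D)) (exactly D k') m) ⟩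
    σ (suc k) (λ k' → σ (suc t) (λ t' → conv (exactly D k') (exactly (suc D) t') m)) ∎

  private
    block-weight : ∀ D k t → 2 * (suc D * suc (suc D)) + (2 * k + 2 * t) ≡ 2 * (suc D + suc D + k + t) + 2 * (D * suc D)
    block-weight = solve-∀

  -- Removing the first row and first column from a block with rectangle D+1
  -- leaves a block with rectangle D and at most k extra columns and t extra rows.
  block-suc : ∀ D k t n → block (suc D) k t n ≡ shift (2 * (suc D + suc D + k + t)) (blocksWithin (suc D + k) (D + t) D) n
  block-suc D k t n = begin
    shift E3 (conv (shift (2 * k) (gauss D k)) (shift (2 * t) (gauss (suc D) t))) n
      ≡⟨ shift-cong E3 (conv-shift² (2 * k) (2 * t) (gauss D k) (gauss (suc D) t)) n ⟩
    shift E3 (shift (2 * k + 2 * t) (conv (gauss D k) (gauss (suc D) t))) n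
      ≡⟨ shift-shift≡ E3 (2 * k + 2 * t) (E1 + E2) _ n (block-weight D k t) ⟩
    shift (E1 + E2) (conv (gauss D k) (gauss (suc D) t)) n
      ≡⟨ sym (shift-shift E1 E2 _ n) ⟩
    shift E1 (shift E2 (conv (gauss D k) (gauss (suc D) t))) n
      ≡⟨ shift-cong E1 (λ m → trans (shift-cong E2 (conv-gauss-exactly D k t) m)
           (trans (shift-σ E2 (suc k) (λ k' m' → σ (suc t) (λ t' → conv (exactly D k') (exactly (suc D) t') m')) m)
                  (σ-cong (suc k) (λ k' → shift-σ E2 (suc t) (λ t' → conv (exactly D k') (exactly (suc D) t')) m)))) n ⟩
    shift E1 (λ m → σ (suc k) (λ k' → σ (suc t) (λ t' → block D k' t' m))) n
      ≡⟨ shift-cong E1 (λ m → cong₂ (λ x y → σ (suc x) (λ k' → σ (suc y) (λ t' → block D k' t' m)))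
                                     (sym (m+n∸m≡n (suc D) k)) (sym (m+n∸m≡n D t))) n ⟩
    shift E1 (blocksWithin (suc D + k) (D + t) D) n ∎
    where
    E1 = 2 * (suc D + suc D + k + t)
    E2 = 2 * (D * suc D)
    E3 = 2 * (suc D * suc (suc D))

  blocks-fixed-rectangle : ∀ a l n D → D ≤ l →
    σ (suc a) (λ a' → σ (suc l) (λ l' → guard D l' (guard (suc D) a' (block D (a' ∸ suc D) (l' ∸ D) n))))
    ≡ guard (suc D) a (blocksWithin a l D n)
  blocks-fixed-rectangle a l n D le = begin
    σ (suc a) (λ a' → σ (suc l) (λ l' → guard D l' (guard (suc D) a' (block D (a' ∸ suc D) (l' ∸ D) n))))
      ≡⟨ σ-cong (suc a) (λ a' → trans (σ-cong (suc l) (λ l' → guard-comm D l' (suc D) a' (block D (a' ∸ suc D) (l' ∸ D) n)))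
                                        (σ-guard-out (suc l) (suc D) a' (λ l' → guard D l' (block D (a' ∸ suc D) (l' ∸ D) n)))) ⟩
    σ (suc a) (λ a' → guard (suc D) a' (σ (suc l) (λ l' → guard D l' (block D (a' ∸ suc D) (l' ∸ D) n))))
      ≡⟨ σ-guard (suc D) a (λ a' → σ (suc l) (λ l' → guard D l' (block D (a' ∸ suc D) (l' ∸ D) n))) ⟩
    guard (suc D) a (σ (suc (a ∸ suc D)) (λ k' → σ (suc l) (λ l' → guard D l' (block D (suc D + k' ∸ suc D) (l' ∸ D) n))))
      ≡⟨ cong (guard (suc D) a) (σ-cong (suc (a ∸ suc D)) (λ k' → trans (σ-guard D l (λ l' → block D (suc D + k' ∸ suc D) (l' ∸ D) n))
            (trans (guard-≤ D l _ le) (σ-cong (suc (l ∸ D)) (λ t' → cong₂ (λ x y → block D x y n) (m+n∸m≡n (suc D) k') (m+n∸m≡n D t')))))) ⟩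
    guard (suc D) a (blocksWithin a l D n) ∎

  durfeeCount-reindex : ∀ a l n →
    σ (suc l) (λ D → guard (suc D) a (blocksWithin a l D n)) ≡ σ (suc a) (λ a' → σ (suc l) (λ l' → durfeeCount a' l' n))
  durfeeCount-reindex a l n = sym (begin
    σ (suc a) (λ a' → σ (suc l) (λ l' → durfeeCount a' l' n))
      ≡⟨ σ-cong (suc a) (λ a' → σ-cong< (suc l) (λ l' p → sym (σ-guard-extend l' l (F a' l') (≤-pred p)))) ⟩
    σ (suc a) (λ a' → σ (suc l) (λ l' → σ (suc l) (λ D → guard D l' (F a' l' D))))
      ≡⟨ σ-cong (suc a) (λ a' → σ-swap (suc l) (suc l) (λ l' D → guard D l' (F a' l' D))) ⟩
    σ (suc a) (λ a' → σ (suc l) (λ D → σ (suc l) (λ l' → guard D l' (F a' l' D))))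
      ≡⟨ σ-swap (suc a) (suc l) (λ a' D → σ (suc l) (λ l' → guard D l' (F a' l' D))) ⟩
    σ (suc l) (λ D → σ (suc a) (λ a' → σ (suc l) (λ l' → guard D l' (F a' l' D))))
      ≡⟨ σ-cong< (suc l) (λ D p → blocks-fixed-rectangle a l n D (≤-pred p)) ⟩
    σ (suc l) (λ D → guard (suc D) a (blocksWithin a l D n)) ∎)
    where
    F : ℕ → ℕ → ℕ → ℕ
    F a' l' D = guard (suc D) a' (block D (a' ∸ suc D) (l' ∸ D) n)

  private
    hook-weight : ∀ D a' l' → 2 * (suc D + suc D + a' + l') ≡ 2 * suc ((suc D + a') + (D + l'))
    hook-weight = solve-∀

  -- Peeling the hook (first row and first column, a + l + 1 cells) off every
  -- block with rectangle ≥ 1: what remains has largest part ≤ a and ≤ l parts.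
  durfeeCount-peel : ∀ a l n → durfeeCount (suc a) (suc l) n
    ≡ block 0 a (suc l) n + shift (2 * suc (a + l)) (λ m → σ (suc a) (λ a' → σ (suc l) (λ l' → durfeeCount a' l' m))) n
  durfeeCount-peel a l n = begin
    block 0 a (suc l) n + σ (suc l) (λ D → guard (suc D) a (block (suc D) (a ∸ suc D) (l ∸ D) n))
      ≡⟨ cong (block 0 a (suc l) n +_) (σ-cong< (suc l) (λ D p → peel D (≤-pred p))) ⟩
    block 0 a (suc l) n + σ (suc l) (λ D → shift E (λ m → guard (suc D) a (blocksWithin a l D m)) n)
      ≡⟨ cong (block 0 a (suc l) n +_) (sym (shift-σ E (suc l) (λ D m → guard (suc D) a (blocksWithin a l D m)) n)) ⟩
    block 0 a (suc l) n + shift E (λ m → σ (suc l) (λ D → guard (suc D) a (blocksWithin a l D m))) n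
      ≡⟨ cong (block 0 a (suc l) n +_) (shift-cong E (durfeeCount-reindex a l) n) ⟩
    block 0 a (suc l) n + shift E (λ m → σ (suc a) (λ a' → σ (suc l) (λ l' → durfeeCount a' l' m))) n ∎
    where
    E = 2 * suc (a + l)
    peel : ∀ D → D ≤ l → guard (suc D) a (block (suc D) (a ∸ suc D) (l ∸ D) n) ≡ shift E (λ m → guard (suc D) a (blocksWithin a l D m)) n
    peel D le with split (suc D) a
    ... | lt p = trans (guard-> (suc D) a _ p) (trans (sym (guard-> (suc D) a _ p)) (sym (shift-guard E (suc D) a (blocksWithin a l D) n)))
    ... | ge a' refl = begin
      guard (suc D) (suc D + a') (block (suc D) (suc D + a' ∸ suc D) (l ∸ D) n)
        ≡⟨ cong (guard (suc D) (suc D + a')) (block-suc D _ _ n) ⟩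
      guard (suc D) (suc D + a') (shift (2 * (suc D + suc D + (suc D + a' ∸ suc D) + (l ∸ D))) (blocksWithin (suc D + (suc D + a' ∸ suc D)) (D + (l ∸ D)) D) n)
        ≡⟨ cong₂ (λ x y → guard (suc D) (suc D + a') (shift x (blocksWithin (suc D + y) (D + (l ∸ D)) D) n)) hookLength (m+n∸m≡n (suc D) a') ⟩
      guard (suc D) (suc D + a') (shift E (blocksWithin (suc D + a') (D + (l ∸ D)) D) n)
        ≡⟨ cong (λ y → guard (suc D) (suc D + a') (shift E (blocksWithin (suc D + a') y D) n)) (m+[n∸m]≡n le) ⟩
      guard (suc D) (suc D + a') (shift E (blocksWithin (suc D + a') l D) n)
        ≡⟨ sym (shift-guard E (suc D) (suc D + a') (blocksWithin (suc D + a') l D) n) ⟩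
      shift E (λ m → guard (suc D) (suc D + a') (blocksWithin (suc D + a') l D m)) n ∎
      where
      hookLength : 2 * (suc D + suc D + (suc D + a' ∸ suc D) + (l ∸ D)) ≡ 2 * suc (suc D + a' + l)
      hookLength = trans (cong (λ x → 2 * (suc D + suc D + x + (l ∸ D))) (m+n∸m≡n (suc D) a'))
          (trans (hook-weight D a' (l ∸ D)) (cong (λ y → 2 * suc ((suc D + a') + y)) (m+[n∸m]≡n le)))

  -- the statement proved by strong induction on the number of parts l:
  -- Σ_{a' ≤ a+1} durfeeCount a' l = partitions into exactly l parts ≤ a+1
  CountsParts : ℕ → Set
  CountsParts l = ∀ a n → σ (suc (suc a)) (λ a' → durfeeCount a' l n) ≡ exactly (suc a) l n

  -- Partitions with l+1 parts and largest part a+1 are, after removing the hook,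
  -- the partitions into at most l parts ≤ a.
  durfeeCount-hook : ∀ l → (∀ l' → l' ≤ l → CountsParts l') → ∀ a n → durfeeCount (suc a) (suc l) n ≡ shift (2 * suc (a + l)) (gauss a l) n
  durfeeCount-hook l IH zero n = begin
    durfeeCount 1 (suc l) n
      ≡⟨ durfeeCount-peel 0 l n ⟩
    conv δ (shift (2 * suc l) (gauss 0 (suc l))) n + shift (2 * suc l) (λ m → σ (suc l) (λ l' → durfeeCount 0 l' m) + 0) n
      ≡⟨ cong₂ _+_ (trans (conv-δˡ (shift (2 * suc l) (gauss 0 (suc l))) n) (shift-cong (2 * suc l) (gauss-zero (suc l)) n))
                   (trans (shift-cong (2 * suc l) (λ m → trans (+-identityʳ _) (σ-zero (suc l) (λ l' _ → durfeeCount-zero l' m))) n)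
                          (shift-𝟘 (2 * suc l) n)) ⟩
    shift (2 * suc l) δ n + 0
      ≡⟨ trans (+-identityʳ _) (sym (shift-cong (2 * suc l) (gauss-zero l) n)) ⟩
    shift (2 * suc l) (gauss 0 l) n ∎
  durfeeCount-hook l IH (suc a) n = begin
    durfeeCount (suc (suc a)) (suc l) n
      ≡⟨ durfeeCount-peel (suc a) l n ⟩
    conv 𝟘 (exactly 1 (suc l)) n + shift E (λ m → σ (suc (suc a)) (λ a' → σ (suc l) (λ l' → durfeeCount a' l' m))) n
      ≡⟨ cong₂ _+_ (conv-𝟘 (exactly 1 (suc l)) n) (shift-cong E (λ m → trans (σ-swap (suc (suc a)) (suc l) (λ a' l' → durfeeCount a' l' m))
             (trans (σ-cong< (suc l) (λ l' p → IH l' (≤-pred p) a m)) (sym (gauss-σ-exactly (suc a) l m)))) n) ⟩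
    shift E (gauss (suc a) l) n ∎
    where E = 2 * suc (suc a + l)

  countsParts-zero : CountsParts 0
  countsParts-zero a n = begin
    (0 + 0) + ((conv δ δ n + 0) + σ a (λ a' → conv 𝟘 (shift 0 (gauss 0 0)) n + 0))
      ≡⟨ cong (λ x → (0 + 0) + ((x + 0) + σ a (λ a' → conv 𝟘 (shift 0 (gauss 0 0)) n + 0))) (conv-δˡ δ n) ⟩
    (δ n + 0) + σ a (λ a' → conv 𝟘 (shift 0 (gauss 0 0)) n + 0)
      ≡⟨ cong ((δ n + 0) +_) (σ-zero a (λ a' _ → trans (+-identityʳ _) (conv-𝟘 (shift 0 (gauss 0 0)) n))) ⟩
    (δ n + 0) + 0
      ≡⟨ trans (+-identityʳ _) (+-identityʳ _) ⟩
    δ n ∎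

  private
    2*suc-+ : ∀ l a → 2 * suc l + 2 * suc a ≡ 2 * suc (suc a + l)
    2*suc-+ = solve-∀

  -- summing the hook formula over the largest part gives the Pascal recursion of gauss
  countsParts-suc : ∀ l → (∀ a n → durfeeCount (suc a) (suc l) n ≡ shift (2 * suc (a + l)) (gauss a l) n) → CountsParts (suc l)
  countsParts-suc l hook zero n = begin
    durfeeCount 0 (suc l) n + (durfeeCount 1 (suc l) n + 0)
      ≡⟨ cong₂ _+_ (durfeeCount-zero (suc l) n) (trans (+-identityʳ _) (trans (hook 0 n) (shift-cong (2 * suc l) (gauss-zero l) n))) ⟩
    shift (2 * suc l) δ n
      ≡⟨ sym (shift-cong (2 * suc l) (gauss-zero (suc l)) n) ⟩
    shift (2 * suc l) (gauss 0 (suc l)) n ∎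
  countsParts-suc l hook (suc a) n = begin
    σ (suc (suc (suc a))) (λ a' → durfeeCount a' (suc l) n)
      ≡⟨ σ-last (suc (suc a)) (λ a' → durfeeCount a' (suc l) n) ⟩
    σ (suc (suc a)) (λ a' → durfeeCount a' (suc l) n) + durfeeCount (suc (suc a)) (suc l) n
      ≡⟨ cong₂ _+_ (countsParts-suc l hook a n) (hook (suc a) n) ⟩
    shift (2 * suc l) (gauss a (suc l)) n + shift (2 * suc (suc a + l)) (gauss (suc a) l) n
      ≡⟨ cong (shift (2 * suc l) (gauss a (suc l)) n +_) (sym (shift-shift≡ (2 * suc l) (2 * suc a) _ (gauss (suc a) l) n (2*suc-+ l a))) ⟩
    shift (2 * suc l) (gauss a (suc l)) n + shift (2 * suc l) (shift (2 * suc a) (gauss (suc a) l)) n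
      ≡⟨ sym (shift-⊕ (2 * suc l) _ _ n) ⟩
    shift (2 * suc l) (gauss a (suc l) ⊕ shift (2 * suc a) (gauss (suc a) l)) n
      ≡⟨ sym (shift-cong (2 * suc l) (gauss-conjugate a l) n) ⟩
    shift (2 * suc l) (gauss (suc a) (suc l)) n ∎

  countsParts-≤ : ∀ l l' → l' ≤ l → CountsParts l'
  countsParts-≤ zero    .zero z≤n = countsParts-zero
  countsParts-≤ (suc l) l'    le with m≤n⇒m<n∨m≡n le
  ... | inj₁ (s≤s p) = countsParts-≤ l l' p
  ... | inj₂ refl    = countsParts-suc l (durfeeCount-hook l (countsParts-≤ l))

  countsParts : ∀ l → CountsParts l
  countsParts l = countsParts-≤ l l ≤-refl

  durfeeCount-suc : ∀ a l n → durfeeCount (suc a) (suc l) n ≡ shift (2 * suc (a + l)) (gauss a l) n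
  durfeeCount-suc a l = durfeeCount-hook l (countsParts-≤ l) a

  -- a nonempty largest part needs at least one part
  durfeeCount-noParts : ∀ a n → durfeeCount (suc (suc a)) 0 n ≡ 0
  durfeeCount-noParts a n = trans (+-identityʳ _) (conv-𝟘 (exactly 1 0) n)

  -- a partition of n (weight 2n) has largest part ≤ n + 1 and at most n parts
  durfeeCount-vanishᵃ : ∀ a l N → suc (suc N) ≤ a → durfeeCount a l N ≡ 0
  durfeeCount-vanishᵃ (suc (suc a)) zero N p = durfeeCount-noParts a N
  durfeeCount-vanishᵃ (suc zero) zero N (s≤s ())
  durfeeCount-vanishᵃ (suc a) (suc l) N p = trans (durfeeCount-suc a l N) (shift-< _ _ N
    (≤-trans (≤-pred p) (≤-trans (≤-trans (m≤m+n a l) (n≤1+n (a + l))) (n≤2*n (suc (a + l))))))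

  durfeeCount-vanishˡ : ∀ a l N → N < l → durfeeCount a l N ≡ 0
  durfeeCount-vanishˡ zero l N p = durfeeCount-zero l N
  durfeeCount-vanishˡ (suc a) (suc l) N p = trans (durfeeCount-suc a l N) (shift-< _ _ N
    (≤-trans p (≤-trans (s≤s (m≤n+m l a)) (n≤2*n (suc (a + l))))))

  private
    2*suc-+0 : ∀ a → 2 * suc (suc a + 0) ≡ 2 * (a + 2)
    2*suc-+0 = solve-∀
    2*-+2 : ∀ a J → 2 * (a + 2) + 2 * suc J ≡ 2 * suc (suc a + suc J)
    2*-+2 = solve-∀

  -- largest part exactly a + 2 and at most J + 1 parts: remove the first part
  durfeeCount-column : ∀ a J n → σ (suc (suc J)) (λ l → durfeeCount (suc (suc a)) l n) ≡ shift (2 * (a + 2)) (gauss (suc (suc a)) J) n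
  durfeeCount-column a zero n = begin
    durfeeCount (suc (suc a)) 0 n + (durfeeCount (suc (suc a)) 1 n + 0)
      ≡⟨ cong₂ _+_ (durfeeCount-noParts a n) (trans (+-identityʳ _) (durfeeCount-suc (suc a) 0 n)) ⟩
    shift (2 * suc (suc a + 0)) δ n
      ≡⟨ shift-≡ δ n (2*suc-+0 a) ⟩
    shift (2 * (a + 2)) δ n ∎
  durfeeCount-column a (suc J) n = begin
    σ (suc (suc (suc J))) (λ l → durfeeCount (suc (suc a)) l n)
      ≡⟨ σ-last (suc (suc J)) (λ l → durfeeCount (suc (suc a)) l n) ⟩
    σ (suc (suc J)) (λ l → durfeeCount (suc (suc a)) l n) + durfeeCount (suc (suc a)) (suc (suc J)) n
      ≡⟨ cong₂ _+_ (durfeeCount-column a J n) (durfeeCount-suc (suc a) (suc J) n) ⟩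
    shift (2 * (a + 2)) (gauss (suc (suc a)) J) n + shift (2 * suc (suc a + suc J)) (gauss (suc a) (suc J)) n
      ≡⟨ cong (shift (2 * (a + 2)) (gauss (suc (suc a)) J) n +_) (sym (shift-shift≡ (2 * (a + 2)) _ _ (gauss (suc a) (suc J)) n (2*-+2 a J))) ⟩
    shift (2 * (a + 2)) (gauss (suc (suc a)) J) n + shift (2 * (a + 2)) (shift (2 * suc J) (gauss (suc a) (suc J))) n
      ≡⟨ sym (shift-⊕ (2 * (a + 2)) _ _ n) ⟩
    shift (2 * (a + 2)) (gauss (suc (suc a)) (suc J)) n ∎

-- The two partition identities behind the theorem (all in the variable q²):
--   durfee-identity      durfeeSeries m = boundedSeries m
--   complement-identity  boundedSeries m + q^(2m+6) boundedSeries (m+3) = partitions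
-- where durfeeSeries m is the generating function of odd Durfee symbols of
-- rank m (up to the factor q^(m+1), see `D⁰₁-durfeeSeries`) and boundedSeries m
-- counts the partitions whose largest part exceeds the number of parts by at most m+1.
module PartitionIdentities where

  open PowerSeries
  open Gaussian
  open DurfeeRectangles

  -- rectangle D × (D+1), t rows ≤ D+1 below it, and to its right a partition into at most t+m parts ≤ D
  durfeeTerm : ℕ → ℕ → ℕ → Series
  durfeeTerm m D t = shift (2 * (D * suc D)) (conv (gauss D (t + m)) (exactly (suc D) t))

  durfeeSeries : ℕ → Series
  durfeeSeries m N = σ (suc N) (λ D → σ (suc N) (λ t → durfeeTerm m D t N))

  -- partitions into exactly l parts, each ≤ l + m + 1
  boundedSeries : ℕ → Series
  boundedSeries m N = σ (suc N) (λ l → shift (2 * l) (gauss (l + m) l) N)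

  -- all partitions: at the coefficient of q^(2N) the bounds N+1 (parts) and N (number) are not restrictive
  partitions : Series
  partitions N = gauss (suc N) N N

  durfeeTerm-blocks : ∀ m D t N → durfeeTerm m D t N ≡ σ (suc (t + m)) (λ k → block D k t N)
  durfeeTerm-blocks m D t N = trans
    (shift-cong (2 * (D * suc D)) (λ x → trans (conv-cong {g = exactly (suc D) t} {g' = exactly (suc D) t} (gauss-σ-exactly D (t + m)) (λ _ → refl) x)
                                                (conv-sumSeriesˡ (suc (t + m)) (exactly D) (exactly (suc D) t) x)) N)
    (shift-σ (2 * (D * suc D)) (suc (t + m)) (λ k → conv (exactly D k) (exactly (suc D) t)) N)

  -- a block has weight at least 2D(D+1) + 2t ≥ D + t
  block-vanish : ∀ D k t N → N < 2 * (D * suc D) + 2 * t → block D k t N ≡ 0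
  block-vanish D k t N p = begin
    shift (2 * (D * suc D)) (conv (exactly D k) (shift (2 * t) (gauss D t))) N
      ≡⟨ shift-cong (2 * (D * suc D)) (conv-shiftʳ (2 * t) (exactly D k) (gauss D t)) N ⟩
    shift (2 * (D * suc D)) (shift (2 * t) (conv (exactly D k) (gauss D t))) N
      ≡⟨ shift-shift (2 * (D * suc D)) (2 * t) _ N ⟩
    shift (2 * (D * suc D) + 2 * t) (conv (exactly D k) (gauss D t)) N
      ≡⟨ shift-< _ _ N p ⟩
    0 ∎

  D+t≤offset : ∀ D t → D + t ≤ 2 * (D * suc D) + 2 * t
  D+t≤offset D t = +-mono-≤ (≤-trans (m≤m*n D (suc D)) (n≤2*n (D * suc D))) (n≤2*n t)

  durfeeTerm-vanish : ∀ m D t N → N < D + t → durfeeTerm m D t N ≡ 0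
  durfeeTerm-vanish m D t N p = trans (durfeeTerm-blocks m D t N)
    (σ-zero (suc (t + m)) (λ k _ → block-vanish D k t N (<-≤-trans p (D+t≤offset D t))))

  boundedSeries-term : ∀ m l N → shift (2 * l) (gauss (l + m) l) N ≡ σ (suc l) (λ D → σ (suc ((l ∸ D) + m)) (λ k → block D k (l ∸ D) N))
  boundedSeries-term m l N = begin
    exactly (suc (l + m)) l N
      ≡⟨ sym (countsParts l (l + m) N) ⟩
    σ (suc (suc (l + m))) (λ a → σ (suc l) (λ D → guard (suc D) a (block D (a ∸ suc D) (l ∸ D) N)))
      ≡⟨ σ-swap (suc (suc (l + m))) (suc l) (λ a D → guard (suc D) a (block D (a ∸ suc D) (l ∸ D) N)) ⟩
    σ (suc l) (λ D → σ (suc (suc (l + m))) (λ a → guard (suc D) a (block D (a ∸ suc D) (l ∸ D) N)))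
      ≡⟨ σ-cong< (suc l) (λ D p → trans (σ-guard (suc D) (suc (l + m)) (λ a → block D (a ∸ suc D) (l ∸ D) N))
           (trans (guard-≤ (suc D) (suc (l + m)) _ (s≤s (≤-trans (≤-pred p) (m≤m+n l m))))
             (trans (cong (λ x → σ (suc x) (λ k → block D (suc D + k ∸ suc D) (l ∸ D) N)) (+-∸-comm m (≤-pred p)))
               (σ-cong (suc ((l ∸ D) + m)) (λ k → cong (λ x → block D x (l ∸ D) N) (m+n∸m≡n (suc D) k)))))) ⟩
    σ (suc l) (λ D → σ (suc ((l ∸ D) + m)) (λ k → block D k (l ∸ D) N)) ∎

  -- Both sides sum the blocks with rectangle D, t = l - D rows below and k ≤ t + m columns to the right.
  durfee-identity : ∀ m N → durfeeSeries m N ≡ boundedSeries m N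
  durfee-identity m N = begin
    σ (suc N) (λ D → σ (suc N) (λ t → durfeeTerm m D t N))
      ≡⟨ σ-cong< (suc N) (λ D p → trans (σ-truncate (suc (N ∸ D)) (suc N) _ (s≤s (m∸n≤m N D)) (beyond D (≤-pred p)))
                                         (σ-cong (suc (N ∸ D)) (λ t → durfeeTerm-blocks m D t N))) ⟩
    σ (suc N) (λ D → σ (suc (N ∸ D)) (λ t → σ (suc (t + m)) (λ k → block D k t N)))
      ≡⟨ sym (σ-triangle N (λ D t → σ (suc (t + m)) (λ k → block D k t N))) ⟩
    σ (suc N) (λ l → σ (suc l) (λ D → σ (suc ((l ∸ D) + m)) (λ k → block D k (l ∸ D) N)))
      ≡⟨ sym (σ-cong (suc N) (λ l → boundedSeries-term m l N)) ⟩
    boundedSeries m N ∎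
    where
    beyond : ∀ D → D ≤ N → ∀ t → suc (N ∸ D) ≤ t → durfeeTerm m D t N ≡ 0
    beyond D le t q = durfeeTerm-vanish m D t N (subst (_< D + t) (m+[n∸m]≡n le) (+-monoʳ-< D q))

  partitions-by-shape : ∀ N → partitions N ≡ σ (suc N) (λ l → σ (suc (suc N)) (λ a → durfeeCount a l N))
  partitions-by-shape N = begin
    gauss (suc N) N N                                          ≡⟨ gauss-σ-exactly (suc N) N N ⟩
    σ (suc N) (λ l → exactly (suc N) l N)                      ≡⟨ σ-cong (suc N) (λ l → sym (countsParts l N N)) ⟩
    σ (suc N) (λ l → σ (suc (suc N)) (λ a → durfeeCount a l N)) ∎

  complement-small : ∀ m N → σ (suc N) (λ l → σ (suc (suc N)) (λ a → guard a (suc (l + m)) (durfeeCount a l N))) ≡ boundedSeries m N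
  complement-small m N = σ-cong (suc N) (λ l →
    trans (σ-guard-extend′ (suc N) (suc (l + m)) (λ a → durfeeCount a l N) (λ a p → durfeeCount-vanishᵃ a l N p))
          (countsParts l (l + m) N))

  largeTerm : ℕ → ℕ → Series
  largeTerm m u = shift (2 * u) (gauss (u + (m + 3)) u)

  private
    m+2+suc : ∀ m u → suc (suc (m + suc u)) ≡ u + (m + 3)
    m+2+suc = solve-∀
    2m+6+2u : ∀ m u → 2 * m + 6 + 2 * u ≡ 2 * (m + suc u + 2)
    2m+6+2u = solve-∀
    l+m+2 : ∀ l m → suc (suc (l + m)) ≡ suc (suc m) + l
    l+m+2 = solve-∀

  -- largest part a = m + 3 + u with at most u + 1 parts: remove the first part
  column-largeTerm : ∀ m u N → σ (suc (suc u)) (λ l → durfeeCount (suc (suc m) + suc u) l N) ≡ shift (2 * m + 6) (largeTerm m u) N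
  column-largeTerm m u N = begin
    σ (suc (suc u)) (λ l → durfeeCount (suc (suc (m + suc u))) l N)
      ≡⟨ durfeeCount-column (m + suc u) u N ⟩
    shift (2 * (m + suc u + 2)) (gauss (suc (suc (m + suc u))) u) N
      ≡⟨ cong (λ z → shift (2 * (m + suc u + 2)) (gauss z u) N) (m+2+suc m u) ⟩
    shift (2 * (m + suc u + 2)) (gauss (u + (m + 3)) u) N
      ≡⟨ sym (shift-shift≡ (2 * m + 6) (2 * u) _ (gauss (u + (m + 3)) u) N (2m+6+2u m u)) ⟩
    shift (2 * m + 6) (largeTerm m u) N ∎

  boundedSeries-range : ∀ m K y → suc y ≤ K → σ K (λ u → shift (2 * u) (gauss (u + m) u) y) ≡ boundedSeries m y
  boundedSeries-range m K y le = σ-truncate (suc y) K _ le (λ u q → shift-< (2 * u) _ y (≤-trans q (n≤2*n u)))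

  m+2≤2m+6 : ∀ m → suc (suc m) ≤ 2 * m + 6
  m+2≤2m+6 m = ≤-trans (≤-reflexive (+-comm 2 m)) (+-mono-≤ (n≤2*n m) (s≤s (s≤s z≤n)))

  largeTerms-range : ∀ m N → guard (suc (suc m)) (suc N) (shift (2 * m + 6) (λ x → σ (suc N ∸ suc (suc m)) (λ u → largeTerm m u x)) N)
                           ≡ shift (2 * m + 6) (boundedSeries (m + 3)) N
  largeTerms-range m N with suc (suc m) ≤? suc N
  ... | no c≰ = trans (guard-> (suc (suc m)) (suc N) _ (≰⇒> c≰)) (sym (shift-< (2 * m + 6) _ N
                  (≤-trans (≤-pred (≰⇒> c≰)) (≤-trans (n≤1+n (suc m)) (m+2≤2m+6 m)))))
  ... | yes c≤ = trans (guard-≤ (suc (suc m)) (suc N) _ c≤) (shift-cong-at (2 * m + 6) _ _ N (λ le →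
                   boundedSeries-range (m + 3) (suc N ∸ suc (suc m)) (N ∸ (2 * m + 6)) (bound le)))
    where
    bound : 2 * m + 6 ≤ N → suc (N ∸ (2 * m + 6)) ≤ suc N ∸ suc (suc m)
    bound le = subst (suc (N ∸ (2 * m + 6)) ≤_) (sym (+-∸-assoc 1 (≤-trans (m+2≤2m+6 m) le)))
                     (s≤s (∸-monoʳ-≤ N (m+2≤2m+6 m)))

  -- the partitions with a ≥ l + m + 2, sorted by u = a - (m + 2)
  complement-large : ∀ m N → σ (suc N) (λ l → σ (suc (suc N)) (λ a → guard (suc (suc (l + m))) a (durfeeCount a l N)))
                           ≡ shift (2 * m + 6) (boundedSeries (m + 3)) N
  complement-large m N = begin
    σ (suc N) (λ l → σ (suc (suc N)) (λ a → guard (suc (suc (l + m))) a (durfeeCount a l N)))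
      ≡⟨ σ-cong (suc N) (λ l → σ-cong (suc (suc N)) (λ a →
           trans (cong (λ z → guard z a (durfeeCount a l N)) (l+m+2 l m)) (guard-shift c l a (durfeeCount a l N)))) ⟩
    σ (suc N) (λ l → σ (suc (suc N)) (λ a → guard c a (guard l (a ∸ c) (durfeeCount a l N))))
      ≡⟨ σ-swap (suc N) (suc (suc N)) (λ l a → guard c a (guard l (a ∸ c) (durfeeCount a l N))) ⟩
    σ (suc (suc N)) (λ a → σ (suc N) (λ l → guard c a (guard l (a ∸ c) (durfeeCount a l N))))
      ≡⟨ σ-cong (suc (suc N)) (λ a → trans (σ-guard-out (suc N) c a (λ l → guard l (a ∸ c) (durfeeCount a l N)))
            (cong (guard c a) (σ-guard-extend′ N (a ∸ c) (λ l → durfeeCount a l N) (λ l p → durfeeCount-vanishˡ a l N p)))) ⟩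
    σ (suc (suc N)) (λ a → guard c a (σ (suc (a ∸ c)) (λ l → durfeeCount a l N)))
      ≡⟨ σ-guard c (suc N) (λ a → σ (suc (a ∸ c)) (λ l → durfeeCount a l N)) ⟩
    guard c (suc N) (σ (suc K) (λ u → σ (suc (c + u ∸ c)) (λ l → durfeeCount (c + u) l N)))
      ≡⟨ cong (guard c (suc N)) (σ-cong (suc K) (λ u → cong (λ z → σ (suc z) (λ l → durfeeCount (c + u) l N)) (m+n∸m≡n c u))) ⟩
    guard c (suc N) (σ (suc K) (λ u → σ (suc u) (λ l → durfeeCount (c + u) l N)))
      ≡⟨ cong (guard c (suc N)) (cong₂ _+_ (trans (+-identityʳ _) (durfeeCount-noParts m N)) (σ-cong K (λ u → column-largeTerm m u N))) ⟩
    guard c (suc N) (σ K (λ u → shift (2 * m + 6) (largeTerm m u) N))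
      ≡⟨ cong (guard c (suc N)) (sym (shift-σ (2 * m + 6) K (largeTerm m) N)) ⟩
    guard c (suc N) (shift (2 * m + 6) (λ x → σ K (λ u → largeTerm m u x)) N)
      ≡⟨ largeTerms-range m N ⟩
    shift (2 * m + 6) (boundedSeries (m + 3)) N ∎
    where
    c = suc (suc m)
    K = suc N ∸ c

  -- split every partition according to whether a ≤ l + m + 1
  complement-identity : ∀ m N → boundedSeries m N + shift (2 * m + 6) (boundedSeries (m + 3)) N ≡ partitions N
  complement-identity m N = sym (begin
    partitions N
      ≡⟨ partitions-by-shape N ⟩
    σ (suc N) (λ l → σ (suc (suc N)) (λ a → durfeeCount a l N))
      ≡⟨ σ-cong (suc N) (λ l → trans (σ-cong (suc (suc N)) (λ a → guard-split a (suc (l + m)) (durfeeCount a l N)))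
                                      (σ-+ (suc (suc N)) (small l) (large l))) ⟩
    σ (suc N) (λ l → σ (suc (suc N)) (small l) + σ (suc (suc N)) (large l))
      ≡⟨ σ-+ (suc N) (λ l → σ (suc (suc N)) (small l)) (λ l → σ (suc (suc N)) (large l)) ⟩
    σ (suc N) (λ l → σ (suc (suc N)) (small l)) + σ (suc N) (λ l → σ (suc (suc N)) (large l))
      ≡⟨ cong₂ _+_ (complement-small m N) (complement-large m N) ⟩
    boundedSeries m N + shift (2 * m + 6) (boundedSeries (m + 3)) N ∎)
    where
    small large : ℕ → ℕ → ℕ
    small l a = guard a (suc (l + m)) (durfeeCount a l N)
    large l a = guard (suc (suc (l + m))) a (durfeeCount a l N)

module ListSums where

  open PowerSeries

  𝟙 : Bool → ℕ
  𝟙 true = 1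
  𝟙 false = 0

  𝟙-∧ : ∀ a b → 𝟙 (a ∧ b) ≡ 𝟙 a * 𝟙 b
  𝟙-∧ true b = sym (+-identityʳ _)
  𝟙-∧ false b = refl

  Σl : {I : Set} → List I → (I → ℕ) → ℕ
  Σl [] f = 0
  Σl (x ∷ xs) f = f x + Σl xs f

  module _ {I : Set} where
    Σl-cong : ∀ (xs : List I) {f g : I → ℕ} → (∀ x → f x ≡ g x) → Σl xs f ≡ Σl xs g
    Σl-cong [] e = refl
    Σl-cong (x ∷ xs) e = cong₂ _+_ (e x) (Σl-cong xs e)

    Σl-++ : ∀ (xs ys : List I) f → Σl (xs ++ ys) f ≡ Σl xs f + Σl ys f
    Σl-++ [] ys f = refl
    Σl-++ (x ∷ xs) ys f = trans (cong (f x +_) (Σl-++ xs ys f)) (sym (+-assoc (f x) _ _))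

    Σl-zero : ∀ (xs : List I) {f : I → ℕ} → (∀ x → f x ≡ 0) → Σl xs f ≡ 0
    Σl-zero [] e = refl
    Σl-zero (x ∷ xs) e = cong₂ _+_ (e x) (Σl-zero xs e)

    Σl-*ˡ : ∀ (xs : List I) c f → Σl xs (λ x → c * f x) ≡ c * Σl xs f
    Σl-*ˡ [] c f = sym (*-zeroʳ c)
    Σl-*ˡ (x ∷ xs) c f = trans (cong (c * f x +_) (Σl-*ˡ xs c f)) (sym (*-distribˡ-+ c (f x) _))

    Σl-σ : ∀ (xs : List I) n (F : I → ℕ → ℕ) → Σl xs (λ x → σ n (F x)) ≡ σ n (λ i → Σl xs (λ x → F x i))
    Σl-σ [] n F = sym (σ-zero n (λ _ _ → refl))
    Σl-σ (x ∷ xs) n F = trans (cong (σ n (F x) +_) (Σl-σ xs n F)) (sym (σ-+ n (F x) _))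

  Σl-map : ∀ {I J : Set} (h : I → J) (xs : List I) f → Σl (map h xs) f ≡ Σl xs (λ x → f (h x))
  Σl-map h [] f = refl
  Σl-map h (x ∷ xs) f = cong (f (h x) +_) (Σl-map h xs f)

  Σl-concatMap : ∀ {I J : Set} (g : I → List J) (xs : List I) f → Σl (concatMap g xs) f ≡ Σl xs (λ x → Σl (g x) f)
  Σl-concatMap g [] f = refl
  Σl-concatMap g (x ∷ xs) f = trans (Σl-++ (g x) (concatMap g xs) f) (cong (Σl (g x) f +_) (Σl-concatMap g xs f))

  Σl-applyUpTo : ∀ {I : Set} (g : ℕ → I) n f → Σl (applyUpTo g n) f ≡ σ n (λ i → f (g i))
  Σl-applyUpTo g zero f = refl
  Σl-applyUpTo g (suc n) f = cong (f (g 0) +_) (Σl-applyUpTo (λ i → g (suc i)) n f)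

  length-filter : ∀ {I : Set} {Pr : I → Set} (P? : ∀ x → Dec (Pr x)) xs → length (filter P? xs) ≡ Σl xs (λ x → 𝟙 (does (P? x)))
  length-filter P? [] = refl
  length-filter P? (x ∷ xs) with does (P? x)
  ... | true = cong suc (length-filter P? xs)
  ... | false = length-filter P? xs

  Σl-listsOfLength : ∀ s vs (f : List ℕ → ℕ → ℕ) → Σl (listsOfLength s vs) (λ a → f a (length a)) ≡ Σl (listsOfLength s vs) (λ a → f a s)
  Σl-listsOfLength zero vs f = refl
  Σl-listsOfLength (suc s) vs f = begin
    Σl (concatMap (λ v → map (v ∷_) (listsOfLength s vs)) vs) (λ a → f a (length a))
      ≡⟨ Σl-concatMap _ vs _ ⟩
    Σl vs (λ v → Σl (map (v ∷_) (listsOfLength s vs)) (λ a → f a (length a)))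
      ≡⟨ Σl-cong vs (λ v → trans (Σl-map (v ∷_) (listsOfLength s vs) _) (Σl-listsOfLength s vs (λ r l → f (v ∷ r) (suc l)))) ⟩
    Σl vs (λ v → Σl (listsOfLength s vs) (λ r → f (v ∷ r) (suc s)))
      ≡⟨ sym (Σl-cong vs (λ v → Σl-map (v ∷_) (listsOfLength s vs) _)) ⟩
    Σl vs (λ v → Σl (map (v ∷_) (listsOfLength s vs)) (λ a → f a (suc s)))
      ≡⟨ sym (Σl-concatMap _ vs _) ⟩
    Σl (concatMap (λ v → map (v ∷_) (listsOfLength s vs)) vs) (λ a → f a (suc s)) ∎

  ≤ᵇ-true : ∀ {x y} → x ≤ y → (x ≤ᵇ y) ≡ true
  ≤ᵇ-true p = Equivalence.to T-≡ (≤⇒≤ᵇ p)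

  ≤ᵇ-false : ∀ {x y} → y < x → (x ≤ᵇ y) ≡ false
  ≤ᵇ-false {suc x} {zero} p = refl
  ≤ᵇ-false {suc zero} {suc y} (s≤s ())
  ≤ᵇ-false {suc (suc x)} {suc y} (s≤s p) = ≤ᵇ-false {suc x} {y} p

  ≡ᵇ-false : ∀ {x y} → x ≢ y → (x ≡ᵇ y) ≡ false
  ≡ᵇ-false {zero} {zero} p = ⊥-elim (p refl)
  ≡ᵇ-false {zero} {suc y} p = refl
  ≡ᵇ-false {suc x} {zero} p = refl
  ≡ᵇ-false {suc x} {suc y} p = ≡ᵇ-false (λ e → p (cong suc e))

  ≡ᵇ-cancel : ∀ v x w → (v + x ≡ᵇ v + w) ≡ (x ≡ᵇ w)
  ≡ᵇ-cancel zero x w = refl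
  ≡ᵇ-cancel (suc v) x w = ≡ᵇ-cancel v x w

  ≡ᵇ-false-< : ∀ v x w → w < v → (v + x ≡ᵇ w) ≡ false
  ≡ᵇ-false-< v x w p = ≡ᵇ-false (λ e → <⇒≱ p (subst (v ≤_) e (m≤m+n v x)))

  ≡ᵇ-sym : ∀ x y → (x ≡ᵇ y) ≡ (y ≡ᵇ x)
  ≡ᵇ-sym zero    zero    = refl
  ≡ᵇ-sym zero    (suc y) = refl
  ≡ᵇ-sym (suc x) zero    = refl
  ≡ᵇ-sym (suc x) (suc y) = ≡ᵇ-sym x y

  σ-pick : ∀ n z (g : ℕ → ℕ) → σ (suc n) (λ w → g w * 𝟙 (w ≡ᵇ z)) ≡ guard z n (g z)
  σ-pick n zero g = trans (cong₂ _+_ (*-identityʳ (g 0)) (σ-zero n (λ i _ → *-zeroʳ (g (suc i))))) (+-identityʳ _)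
  σ-pick zero (suc z) g = trans (+-identityʳ _) (*-zeroʳ (g 0))
  σ-pick (suc n) (suc z) g = trans (cong (_+ σ (suc n) (λ w → g (suc w) * 𝟙 (w ≡ᵇ z))) (*-zeroʳ (g 0))) (σ-pick n z (λ w → g (suc w)))

  σ-pick′ : ∀ n z (g : ℕ → ℕ) → σ (suc n) (λ w → 𝟙 (z ≡ᵇ w) * g w) ≡ guard z n (g z)
  σ-pick′ n z g = trans (σ-cong (suc n) (λ w → trans (*-comm _ (g w)) (cong (λ b → g w * 𝟙 b) (≡ᵇ-sym z w)))) (σ-pick n z g)

  Σl-*ʳ : ∀ {I : Set} (xs : List I) c f → Σl xs (λ x → f x * c) ≡ Σl xs f * c
  Σl-*ʳ xs c f = trans (Σl-cong xs (λ x → *-comm (f x) c)) (trans (Σl-*ˡ xs c f) (*-comm c _))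
-- A row with bound 2D+1 is a nonincreasing list
-- of odd positive parts ≤ 2D+1; writing each part as 2c+1, it is q^s times a
-- partition into at most s parts ≤ D (weight doubled), so the row series is
-- q^s · gauss D s (`rowSeries-gauss`).
module Rows where

  open PowerSeries
  open Gaussian
  open ListSums

  allInd : (ℕ → Bool) → List ℕ → ℕ
  allInd p [] = 1
  allInd p (x ∷ xs) = 𝟙 (p x) * allInd p xs

  linkedInd : List ℕ → ℕ
  linkedInd [] = 1
  linkedInd (x ∷ []) = 1
  linkedInd (x ∷ y ∷ r) = 𝟙 (y ≤ᵇ x) * linkedInd (y ∷ r)

  -- The row condition with bound B, unfolded recursively: the head is odd,
  -- positive and ≤ B, and the tail is a row with bound equal to the head.
  rowInd : ℕ → List ℕ → ℕ
  rowInd B [] = 1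
  rowInd B (v ∷ r) = 𝟙 (v % 2 ≡ᵇ 1) * (𝟙 (1 ≤ᵇ v) * (𝟙 (v ≤ᵇ B) * rowInd v r))

  all?-𝟙 : ∀ {P : ℕ → Set} (p? : ∀ x → Dec (P x)) xs → 𝟙 (does (all? p? xs)) ≡ allInd (λ x → does (p? x)) xs
  all?-𝟙 p? [] = refl
  all?-𝟙 p? (x ∷ xs) = trans (𝟙-∧ (does (p? x)) _) (cong (𝟙 (does (p? x)) *_) (all?-𝟙 p? xs))

  linked?-𝟙 : ∀ xs → 𝟙 (does (linked? _≥?_ xs)) ≡ linkedInd xs
  linked?-𝟙 [] = refl
  linked?-𝟙 (x ∷ []) = refl
  linked?-𝟙 (x ∷ y ∷ r) = trans (𝟙-∧ (y ≤ᵇ x) _) (cong (𝟙 (y ≤ᵇ x) *_) (linked?-𝟙 (y ∷ r)))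

  rowInd-bound : ∀ v B r → v ≤ B → allInd (λ x → x ≤ᵇ B) r * linkedInd (v ∷ r) ≡ allInd (λ x → x ≤ᵇ v) r * linkedInd r
  rowInd-bound v B [] le = refl
  rowInd-bound v B (y ∷ r) le with y ≤? v
  ... | yes p = begin
    (𝟙 (y ≤ᵇ B) * allInd (λ x → x ≤ᵇ B) r) * (𝟙 (y ≤ᵇ v) * linkedInd (y ∷ r))
      ≡⟨ cong₂ (λ a b → (𝟙 a * allInd (λ x → x ≤ᵇ B) r) * (𝟙 b * linkedInd (y ∷ r))) (≤ᵇ-true (≤-trans p le)) (≤ᵇ-true p) ⟩
    (1 * allInd (λ x → x ≤ᵇ B) r) * (1 * linkedInd (y ∷ r))
      ≡⟨ cong₂ _*_ (*-identityˡ (allInd (λ x → x ≤ᵇ B) r)) (*-identityˡ (linkedInd (y ∷ r))) ⟩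
    allInd (λ x → x ≤ᵇ B) r * linkedInd (y ∷ r)
      ≡⟨ rowInd-bound y B r (≤-trans p le) ⟩
    allInd (λ x → x ≤ᵇ y) r * linkedInd r
      ≡⟨ sym (rowInd-bound y v r p) ⟩
    allInd (λ x → x ≤ᵇ v) r * linkedInd (y ∷ r)
      ≡⟨ sym (trans (cong (λ b → (𝟙 b * allInd (λ x → x ≤ᵇ v) r) * linkedInd (y ∷ r)) (≤ᵇ-true p)) (cong (_* linkedInd (y ∷ r)) (*-identityˡ (allInd (λ x → x ≤ᵇ v) r)))) ⟩
    (𝟙 (y ≤ᵇ v) * allInd (λ x → x ≤ᵇ v) r) * linkedInd (y ∷ r) ∎
  ... | no ¬p = begin
    (𝟙 (y ≤ᵇ B) * allInd (λ x → x ≤ᵇ B) r) * (𝟙 (y ≤ᵇ v) * linkedInd (y ∷ r))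
      ≡⟨ cong (λ b → (𝟙 (y ≤ᵇ B) * allInd (λ x → x ≤ᵇ B) r) * (𝟙 b * linkedInd (y ∷ r))) (≤ᵇ-false (≰⇒> ¬p)) ⟩
    (𝟙 (y ≤ᵇ B) * allInd (λ x → x ≤ᵇ B) r) * 0
      ≡⟨ *-zeroʳ (𝟙 (y ≤ᵇ B) * allInd (λ x → x ≤ᵇ B) r) ⟩
    0
      ≡⟨ sym (cong (λ b → (𝟙 b * allInd (λ x → x ≤ᵇ v) r) * linkedInd (y ∷ r)) (≤ᵇ-false (≰⇒> ¬p))) ⟩
    (𝟙 (y ≤ᵇ v) * allInd (λ x → x ≤ᵇ v) r) * linkedInd (y ∷ r) ∎

  private
    pull-ones : ∀ o a p b c d → (o * a) * ((p * b) * ((1 * c) * d)) ≡ o * (p * (1 * (a * (b * (c * d)))))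
    pull-ones = solve-∀
    pull-zero : ∀ o a p b c d e → (o * a) * ((p * b) * ((0 * c) * d)) ≡ o * (p * (0 * e))
    pull-zero = solve-∀

  rowInd-product : ∀ B xs → allInd (λ x → x % 2 ≡ᵇ 1) xs * (allInd (λ x → 1 ≤ᵇ x) xs * (allInd (λ x → x ≤ᵇ B) xs * linkedInd xs)) ≡ rowInd B xs
  rowInd-product B [] = refl
  rowInd-product B (v ∷ r) with v ≤? B
  ... | yes le = begin
    (o * AO) * ((p * AP) * ((𝟙 (v ≤ᵇ B) * allInd (λ x → x ≤ᵇ B) r) * linkedInd (v ∷ r)))
      ≡⟨ cong (λ z → (o * AO) * ((p * AP) * ((𝟙 z * allInd (λ x → x ≤ᵇ B) r) * linkedInd (v ∷ r)))) (≤ᵇ-true le) ⟩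
    (o * AO) * ((p * AP) * ((1 * allInd (λ x → x ≤ᵇ B) r) * linkedInd (v ∷ r)))
      ≡⟨ pull-ones o AO p AP (allInd (λ x → x ≤ᵇ B) r) (linkedInd (v ∷ r)) ⟩
    o * (p * (1 * (AO * (AP * (allInd (λ x → x ≤ᵇ B) r * linkedInd (v ∷ r))))))
      ≡⟨ cong (λ z → o * (p * (1 * (AO * (AP * z))))) (rowInd-bound v B r le) ⟩
    o * (p * (1 * (AO * (AP * (allInd (λ x → x ≤ᵇ v) r * linkedInd r)))))
      ≡⟨ cong (λ z → o * (p * (1 * z))) (rowInd-product v r) ⟩
    o * (p * (1 * rowInd v r))
      ≡⟨ cong (λ z → o * (p * (𝟙 z * rowInd v r))) (sym (≤ᵇ-true le)) ⟩
    o * (p * (𝟙 (v ≤ᵇ B) * rowInd v r)) ∎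
    where
    o = 𝟙 (v % 2 ≡ᵇ 1)
    p = 𝟙 (1 ≤ᵇ v)
    AO = allInd (λ x → x % 2 ≡ᵇ 1) r
    AP = allInd (λ x → 1 ≤ᵇ x) r
  ... | no ¬le = begin
    (o * AO) * ((p * AP) * ((𝟙 (v ≤ᵇ B) * allInd (λ x → x ≤ᵇ B) r) * linkedInd (v ∷ r)))
      ≡⟨ cong (λ z → (o * AO) * ((p * AP) * ((𝟙 z * allInd (λ x → x ≤ᵇ B) r) * linkedInd (v ∷ r)))) (≤ᵇ-false (≰⇒> ¬le)) ⟩
    (o * AO) * ((p * AP) * ((0 * allInd (λ x → x ≤ᵇ B) r) * linkedInd (v ∷ r)))
      ≡⟨ pull-zero o AO p AP (allInd (λ x → x ≤ᵇ B) r) (linkedInd (v ∷ r)) (rowInd v r) ⟩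
    o * (p * (0 * rowInd v r))
      ≡⟨ cong (λ z → o * (p * (𝟙 z * rowInd v r))) (sym (≤ᵇ-false (≰⇒> ¬le))) ⟩
    o * (p * (𝟙 (v ≤ᵇ B) * rowInd v r)) ∎
    where
    o = 𝟙 (v % 2 ≡ᵇ 1)
    p = 𝟙 (1 ≤ᵇ v)
    AO = allInd (λ x → x % 2 ≡ᵇ 1) r
    AP = allInd (λ x → 1 ≤ᵇ x) r

  validRow?-𝟙 : ∀ D xs → 𝟙 (does (validRow? D xs)) ≡ rowInd (2 * D + 1) xs
  validRow?-𝟙 D xs = begin
    𝟙 (does (all? (λ x → x % 2 ≟ 1) xs) ∧ (does (all? (0 <?_) xs) ∧ (does (all? (_≤? 2 * D + 1) xs) ∧ does (linked? _≥?_ xs))))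
      ≡⟨ trans (𝟙-∧ a1 _) (cong (𝟙 a1 *_) (trans (𝟙-∧ a2 _) (cong (𝟙 a2 *_) (𝟙-∧ a3 a4)))) ⟩
    𝟙 (does (all? (λ x → x % 2 ≟ 1) xs)) * (𝟙 (does (all? (0 <?_) xs)) * (𝟙 (does (all? (_≤? 2 * D + 1) xs)) * 𝟙 (does (linked? _≥?_ xs))))
      ≡⟨ cong₂ _*_ (all?-𝟙 _ xs) (cong₂ _*_ (all?-𝟙 _ xs) (cong₂ _*_ (all?-𝟙 _ xs) (linked?-𝟙 xs))) ⟩
    allInd (λ x → x % 2 ≡ᵇ 1) xs * (allInd (λ x → 1 ≤ᵇ x) xs * (allInd (λ x → x ≤ᵇ 2 * D + 1) xs * linkedInd xs))
      ≡⟨ rowInd-product (2 * D + 1) xs ⟩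
    rowInd (2 * D + 1) xs ∎
    where
    a1 = does (all? (λ x → x % 2 ≟ 1) xs)
    a2 = does (all? (0 <?_) xs)
    a3 = does (all? (_≤? 2 * D + 1) xs)
    a4 = does (linked? _≥?_ xs)

  rowSeries : ℕ → ℕ → ℕ → ℕ → ℕ
  rowSeries n B s w = Σl (listsOfLength s (applyUpTo suc n)) (λ a → rowInd B a * 𝟙 (sum a ≡ᵇ w))

  partInd : ℕ → ℕ → ℕ
  partInd B v = 𝟙 (v % 2 ≡ᵇ 1) * (𝟙 (1 ≤ᵇ v) * 𝟙 (v ≤ᵇ B))

  Σl-shift : ∀ {I : Set} (rows : List I) (F k : I → ℕ) v w →
        Σl rows (λ r → F r * 𝟙 (v + k r ≡ᵇ w)) ≡ shift v (λ w' → Σl rows (λ r → F r * 𝟙 (k r ≡ᵇ w'))) w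
  Σl-shift rows F k v w with split v w
  ... | lt p = trans (Σl-zero rows (λ r → trans (cong (λ z → F r * 𝟙 z) (≡ᵇ-false-< v (k r) w p)) (*-zeroʳ (F r)))) (sym (shift-< v _ w p))
  ... | ge w' refl = trans (Σl-cong rows (λ r → cong (λ z → F r * 𝟙 z) (≡ᵇ-cancel v (k r) w'))) (sym (shift-+ v _ w'))

  private
    regroup : ∀ o p q x y → (o * (p * (q * x))) * y ≡ (o * (p * q)) * (x * y)
    regroup = solve-∀

  rowSeries-suc : ∀ n B s w → rowSeries n B (suc s) w ≡ σ n (λ i → partInd B (suc i) * shift (suc i) (rowSeries n (suc i) s) w)
  rowSeries-suc n B s w = begin
    Σl (concatMap (λ v → map (v ∷_) rows) vs) (λ a → rowInd B a * 𝟙 (sum a ≡ᵇ w))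
      ≡⟨ Σl-concatMap (λ v → map (v ∷_) rows) vs _ ⟩
    Σl vs (λ v → Σl (map (v ∷_) rows) (λ a → rowInd B a * 𝟙 (sum a ≡ᵇ w)))
      ≡⟨ Σl-cong vs (λ v → Σl-map (v ∷_) rows _) ⟩
    Σl vs (λ v → Σl rows (λ r → rowInd B (v ∷ r) * 𝟙 (v + sum r ≡ᵇ w)))
      ≡⟨ Σl-cong vs (λ v → trans (Σl-cong rows (λ r → regroup (𝟙 (v % 2 ≡ᵇ 1)) (𝟙 (1 ≤ᵇ v)) (𝟙 (v ≤ᵇ B)) (rowInd v r) _))
                                   (Σl-*ˡ rows (partInd B v) (λ r → rowInd v r * 𝟙 (v + sum r ≡ᵇ w)))) ⟩
    Σl vs (λ v → partInd B v * Σl rows (λ r → rowInd v r * 𝟙 (v + sum r ≡ᵇ w)))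
      ≡⟨ Σl-cong vs (λ v → cong (partInd B v *_) (Σl-shift rows (rowInd v) sum v w)) ⟩
    Σl vs (λ v → partInd B v * shift v (rowSeries n v s) w)
      ≡⟨ Σl-applyUpTo suc n _ ⟩
    σ n (λ i → partInd B (suc i) * shift (suc i) (rowSeries n (suc i) s) w) ∎
    where
    vs = applyUpTo suc n
    rows = listsOfLength s vs

  σ-pairs : ∀ K h → σ (K + K) h ≡ σ K (λ c → h (c + c) + h (suc (c + c)))
  σ-pairs zero h = refl
  σ-pairs (suc K) h = begin
    σ (suc K + suc K) h
      ≡⟨ cong (λ z → σ (suc z) h) (+-suc K K) ⟩
    h 0 + (h 1 + σ (K + K) (λ i → h (suc (suc i))))
      ≡⟨ cong (λ z → h 0 + (h 1 + z)) (σ-pairs K (λ i → h (suc (suc i)))) ⟩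
    h 0 + (h 1 + σ K (λ c → h (suc (suc (c + c))) + h (suc (suc (suc (c + c))))))
      ≡⟨ sym (+-assoc (h 0) _ _) ⟩
    (h 0 + h 1) + σ K (λ c → h (suc (suc (c + c))) + h (suc (suc (suc (c + c)))))
      ≡⟨ cong ((h 0 + h 1) +_) (σ-cong K (λ c → cong₂ (λ a b → h a + h b) (sym (cong suc (+-suc c c))) (sym (cong (λ z → suc (suc z)) (+-suc c c))))) ⟩
    (h 0 + h 1) + σ K (λ c → h (suc c + suc c) + h (suc (suc c + suc c))) ∎

  private
    odd-exponent : ∀ s c → suc s + 2 * c ≡ suc (c + c) + s
    odd-exponent = solve-∀

  shift-gauss-odd : ∀ D s w → shift (suc s) (gauss D (suc s)) w ≡ σ (suc D) (λ c → shift (suc (c + c)) (shift s (gauss c s)) w)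
  shift-gauss-odd D s w = begin
    shift (suc s) (gauss D (suc s)) w
      ≡⟨ shift-cong (suc s) (gauss-largest D s) w ⟩
    shift (suc s) (sumSeries (suc D) (λ c → shift (2 * c) (gauss c s))) w
      ≡⟨ shift-σ (suc s) (suc D) (λ c → shift (2 * c) (gauss c s)) w ⟩
    σ (suc D) (λ c → shift (suc s) (shift (2 * c) (gauss c s)) w)
      ≡⟨ σ-cong (suc D) (λ c → trans (shift-shift≡ (suc s) (2 * c) _ (gauss c s) w (odd-exponent s c)) (sym (shift-shift (suc (c + c)) s (gauss c s) w))) ⟩
    σ (suc D) (λ c → shift (suc (c + c)) (shift s (gauss c s)) w) ∎

  private
    odd-as-1+2c : ∀ c → suc (c + c) ≡ 1 + c * 2
    odd-as-1+2c = solve-∀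
    even-as-2c : ∀ c → suc (suc (c + c)) ≡ 0 + suc c * 2
    even-as-2c = solve-∀
    2D+1≡ : ∀ D → 2 * D + 1 ≡ suc (D + D)
    2D+1≡ = solve-∀

  odd% : ∀ c → suc (c + c) % 2 ≡ 1
  odd% c = trans (cong (_% 2) (odd-as-1+2c c)) ([m+kn]%n≡m%n 1 c 2)

  even% : ∀ c → suc (suc (c + c)) % 2 ≡ 0
  even% c = trans (cong (_% 2) (even-as-2c c)) ([m+kn]%n≡m%n 0 (suc c) 2)

  partInd-odd : ∀ D c X → partInd (2 * D + 1) (suc (c + c)) * X ≡ guard c D X
  partInd-odd D c X with c ≤? D
  ... | yes le = begin
    𝟙 (suc (c + c) % 2 ≡ᵇ 1) * (1 * 𝟙 (suc (c + c) ≤ᵇ 2 * D + 1)) * X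
      ≡⟨ cong₂ (λ a b → 𝟙 (a ≡ᵇ 1) * (1 * 𝟙 b) * X) (odd% c) (≤ᵇ-true (subst (suc (c + c) ≤_) (sym (2D+1≡ D)) (s≤s (+-mono-≤ le le)))) ⟩
    1 * (1 * 1) * X
      ≡⟨ *-identityˡ X ⟩
    X
      ≡⟨ sym (guard-≤ c D X le) ⟩
    guard c D X ∎
  ... | no ¬le = begin
    𝟙 (suc (c + c) % 2 ≡ᵇ 1) * (1 * 𝟙 (suc (c + c) ≤ᵇ 2 * D + 1)) * X
      ≡⟨ cong (λ b → 𝟙 (suc (c + c) % 2 ≡ᵇ 1) * (1 * 𝟙 b) * X) (≤ᵇ-false (subst (_< suc (c + c)) (sym (2D+1≡ D)) (s≤s (+-mono-< (≰⇒> ¬le) (≰⇒> ¬le))))) ⟩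
    𝟙 (suc (c + c) % 2 ≡ᵇ 1) * (1 * 0) * X
      ≡⟨ cong (_* X) (*-zeroʳ (𝟙 (suc (c + c) % 2 ≡ᵇ 1))) ⟩
    0
      ≡⟨ sym (guard-> c D X (≰⇒> ¬le)) ⟩
    guard c D X ∎

  partInd-even : ∀ B c X → partInd B (suc (suc (c + c))) * X ≡ 0
  partInd-even B c X = cong (λ a → 𝟙 (a ≡ᵇ 1) * (𝟙 (1 ≤ᵇ suc (suc (c + c))) * 𝟙 (suc (suc (c + c)) ≤ᵇ B)) * X) (even% c)

  -- induction on the length: sum over the first part 2c+1, the rest is a row with bound 2c+1
  rowSeries-gauss : ∀ n s D w → w ≤ n → rowSeries n (2 * D + 1) s w ≡ shift s (gauss D s) w
  rowSeries-gauss n zero D zero le = refl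
  rowSeries-gauss n zero D (suc w) le = refl
  rowSeries-gauss n (suc s) D w le = begin
    rowSeries n (2 * D + 1) (suc s) w
      ≡⟨ rowSeries-suc n (2 * D + 1) s w ⟩
    σ n h
      ≡⟨ σ-truncate₂ w n (suc n + suc n) h (λ i p → trans (cong (partInd (2 * D + 1) (suc i) *_) (shift-< (suc i) (rowSeries n (suc i) s) w (s≤s p))) (*-zeroʳ (partInd (2 * D + 1) (suc i)))) le
            (≤-trans le (≤-trans (n≤1+n n) (m≤m+n (suc n) (suc n)))) ⟩
    σ (suc n + suc n) h
      ≡⟨ σ-pairs (suc n) h ⟩
    σ (suc n) (λ c → h (c + c) + h (suc (c + c)))
      ≡⟨ σ-cong (suc n) (λ c → trans (cong₂ _+_ (partInd-odd D c (shift (suc (c + c)) (rowSeries n (suc (c + c)) s) w)) (partInd-even (2 * D + 1) c (shift (suc (suc (c + c))) (rowSeries n (suc (suc (c + c))) s) w))) (+-identityʳ _)) ⟩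
    σ (suc n) (λ c → guard c D (shift (suc (c + c)) (rowSeries n (suc (c + c)) s) w))
      ≡⟨ σ-guard-extend′ n D (λ c → shift (suc (c + c)) (rowSeries n (suc (c + c)) s) w) (λ c p → shift-< (suc (c + c)) _ w (s≤s (≤-trans le (≤-trans (≤-trans (n≤1+n n) p) (m≤m+n c c))))) ⟩
    σ (suc D) (λ c → shift (suc (c + c)) (rowSeries n (suc (c + c)) s) w)
      ≡⟨ σ-cong (suc D) (λ c → shift-cong-at (suc (c + c)) (rowSeries n (suc (c + c)) s) (shift s (gauss c s)) w (λ _ → trans (cong (λ z → rowSeries n z s (w ∸ suc (c + c))) (sym (2D+1≡ c)))
                                (rowSeries-gauss n s c (w ∸ suc (c + c)) (≤-trans (m∸n≤m w (suc (c + c))) le)))) ⟩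
    σ (suc D) (λ c → shift (suc (c + c)) (shift s (gauss c s)) w)
      ≡⟨ sym (shift-gauss-odd D s w) ⟩
    shift (suc s) (gauss D (suc s)) w ∎
    where
    h : ℕ → ℕ
    h i = partInd (2 * D + 1) (suc i) * shift (suc i) (rowSeries n (suc i) s) w

-- From the enumeration to series.  `D⁰₁ m n` counts the candidate symbols
-- (D, α, β) passing the decision procedure; grouping them by D and the row
-- lengths s = |α|, t = |β| turns the count into Σ_{D,s,t} [s - t = m] times the
-- coefficient of qⁿ in q^(2D²+2D+1) · qˢ gauss D s · qᵗ gauss D t.
module SymbolCounting where

  open PowerSeries
  open Gaussian
  open DurfeeRectangles
  open PartitionIdentities
  open ListSums
  open Rows
  open Data.Integer using (+_; -[1+_])

  𝟙-sum-split : ∀ x y c n → 𝟙 (x + y + c ≡ᵇ n) ≡ σ (suc n) (λ w → 𝟙 (x ≡ᵇ w) * σ (suc n) (λ w' → 𝟙 (y ≡ᵇ w') * 𝟙 (w + w' + c ≡ᵇ n)))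
  𝟙-sum-split x y c n = sym (begin
    σ (suc n) (λ w → 𝟙 (x ≡ᵇ w) * σ (suc n) (λ w' → 𝟙 (y ≡ᵇ w') * 𝟙 (w + w' + c ≡ᵇ n)))
      ≡⟨ σ-cong (suc n) (λ w → cong (𝟙 (x ≡ᵇ w) *_) (σ-pick′ n y (λ w' → 𝟙 (w + w' + c ≡ᵇ n)))) ⟩
    σ (suc n) (λ w → 𝟙 (x ≡ᵇ w) * guard y n (𝟙 (w + y + c ≡ᵇ n)))
      ≡⟨ σ-pick′ n x (λ w → guard y n (𝟙 (w + y + c ≡ᵇ n))) ⟩
    guard x n (guard y n (𝟙 (x + y + c ≡ᵇ n))) ≡⟨ drop-guards ⟩
    𝟙 (x + y + c ≡ᵇ n) ∎)
    where
    tooBig : ∀ {u} → n < u → u ≤ x + y + c → 𝟙 (x + y + c ≡ᵇ n) ≡ 0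
    tooBig p q = cong 𝟙 (≡ᵇ-false (λ e → <⇒≱ p (subst (_ ≤_) e q)))
    drop-guards : guard x n (guard y n (𝟙 (x + y + c ≡ᵇ n))) ≡ 𝟙 (x + y + c ≡ᵇ n)
    drop-guards with x ≤? n | y ≤? n
    ... | yes p | yes q = trans (guard-≤ x n _ p) (guard-≤ y n _ q)
    ... | no ¬p | _ = trans (guard-> x n _ (≰⇒> ¬p)) (sym (tooBig (≰⇒> ¬p) (≤-trans (m≤m+n x y) (m≤m+n (x + y) c))))
    ... | yes p | no ¬q = trans (guard-≤ x n _ p) (trans (guard-> y n _ (≰⇒> ¬q)) (sym (tooBig (≰⇒> ¬q) (≤-trans (m≤n+m y x) (m≤m+n (x + y) c)))))

  private
    regroup-indicators : ∀ Fa Gb a b k → Fa * (Gb * (a * (b * k))) ≡ (Fa * a) * (Gb * b) * k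
    regroup-indicators = solve-∀

  Σl-σ² : ∀ {I J : Set} (La : List I) (Lb : List J) (Fa : I → ℕ) (Gb : J → ℕ) (x : I → ℕ) (y : J → ℕ) N (K : ℕ → ℕ → ℕ) →
    Σl La (λ a → Σl Lb (λ b → Fa a * (Gb b * σ N (λ w → 𝟙 (x a ≡ᵇ w) * σ N (λ w' → 𝟙 (y b ≡ᵇ w') * K w w')))))
    ≡ σ N (λ w → σ N (λ w' → Σl La (λ a → Fa a * 𝟙 (x a ≡ᵇ w)) * Σl Lb (λ b → Gb b * 𝟙 (y b ≡ᵇ w')) * K w w'))
  Σl-σ² La Lb Fa Gb x y N K = begin
    Σl La (λ a → Σl Lb (λ b → Fa a * (Gb b * σ N (λ w → 𝟙 (x a ≡ᵇ w) * σ N (λ w' → 𝟙 (y b ≡ᵇ w') * K w w')))))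
      ≡⟨ Σl-cong La (λ a → Σl-cong Lb (λ b → step a b)) ⟩
    Σl La (λ a → Σl Lb (λ b → σ N (λ w → σ N (λ w' → (Fa a * 𝟙 (x a ≡ᵇ w)) * (Gb b * 𝟙 (y b ≡ᵇ w')) * K w w'))))
      ≡⟨ Σl-cong La (λ a → trans (Σl-σ Lb N _) (σ-cong N (λ w → Σl-σ Lb N _))) ⟩
    Σl La (λ a → σ N (λ w → σ N (λ w' → Σl Lb (λ b → (Fa a * 𝟙 (x a ≡ᵇ w)) * (Gb b * 𝟙 (y b ≡ᵇ w')) * K w w'))))
      ≡⟨ trans (Σl-σ La N _) (σ-cong N (λ w → Σl-σ La N _)) ⟩
    σ N (λ w → σ N (λ w' → Σl La (λ a → Σl Lb (λ b → (Fa a * 𝟙 (x a ≡ᵇ w)) * (Gb b * 𝟙 (y b ≡ᵇ w')) * K w w'))))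
      ≡⟨ σ-cong N (λ w → σ-cong N (λ w' → trans (Σl-cong La (λ a →
            trans (Σl-*ʳ Lb (K w w') (λ b → (Fa a * 𝟙 (x a ≡ᵇ w)) * (Gb b * 𝟙 (y b ≡ᵇ w'))))
              (cong (_* K w w') (Σl-*ˡ Lb (Fa a * 𝟙 (x a ≡ᵇ w)) (λ b → Gb b * 𝟙 (y b ≡ᵇ w'))))))
            (trans (Σl-*ʳ La (K w w') _) (cong (_* K w w') (Σl-*ʳ La _ (λ a → Fa a * 𝟙 (x a ≡ᵇ w)))))) ) ⟩
    σ N (λ w → σ N (λ w' → Σl La (λ a → Fa a * 𝟙 (x a ≡ᵇ w)) * Σl Lb (λ b → Gb b * 𝟙 (y b ≡ᵇ w')) * K w w')) ∎
    where
    step : ∀ a b → Fa a * (Gb b * σ N (λ w → 𝟙 (x a ≡ᵇ w) * σ N (λ w' → 𝟙 (y b ≡ᵇ w') * K w w')))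
                 ≡ σ N (λ w → σ N (λ w' → (Fa a * 𝟙 (x a ≡ᵇ w)) * (Gb b * 𝟙 (y b ≡ᵇ w')) * K w w'))
    step a b = begin
      Fa a * (Gb b * σ N (λ w → 𝟙 (x a ≡ᵇ w) * σ N (λ w' → 𝟙 (y b ≡ᵇ w') * K w w')))
        ≡⟨ trans (cong (Fa a *_) (sym (σ-*ˡ N (Gb b) _))) (sym (σ-*ˡ N (Fa a) _)) ⟩
      σ N (λ w → Fa a * (Gb b * (𝟙 (x a ≡ᵇ w) * σ N (λ w' → 𝟙 (y b ≡ᵇ w') * K w w'))))
        ≡⟨ σ-cong N (λ w → trans (cong (λ z → Fa a * (Gb b * z)) (sym (σ-*ˡ N (𝟙 (x a ≡ᵇ w)) _)))
              (trans (cong (Fa a *_) (sym (σ-*ˡ N (Gb b) _))) (sym (σ-*ˡ N (Fa a) _)))) ⟩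
      σ N (λ w → σ N (λ w' → Fa a * (Gb b * (𝟙 (x a ≡ᵇ w) * (𝟙 (y b ≡ᵇ w') * K w w')))))
        ≡⟨ σ-cong N (λ w → σ-cong N (λ w' → regroup-indicators (Fa a) (Gb b) _ _ _)) ⟩
      σ N (λ w → σ N (λ w' → (Fa a * 𝟙 (x a ≡ᵇ w)) * (Gb b * 𝟙 (y b ≡ᵇ w')) * K w w')) ∎

  private
    reorder-sum : ∀ w w' c → w + w' + c ≡ (w + c) + w'
    reorder-sum = solve-∀

  𝟙-sum-guard : ∀ w w' c n → 𝟙 (w + w' + c ≡ᵇ n) ≡ guard (w + c) n (𝟙 (w' ≡ᵇ n ∸ (w + c)))
  𝟙-sum-guard w w' c n with split (w + c) n
  ... | lt p = trans (cong 𝟙 (≡ᵇ-false (λ e → <⇒≱ p (subst ((w + c) ≤_) e (subst ((w + c) ≤_) (sym (reorder-sum w w' c)) (m≤m+n (w + c) w')))))) (sym (guard-> (w + c) n _ p))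
  ... | ge n' refl = trans (cong (λ z → 𝟙 (z ≡ᵇ (w + c) + n')) (reorder-sum w w' c))
                     (trans (cong 𝟙 (≡ᵇ-cancel (w + c) w' n'))
                     (trans (cong (λ z → 𝟙 (w' ≡ᵇ z)) (sym (m+n∸m≡n (w + c) n'))) (sym (guard-+ (w + c) n' _))))

  σ²-conv : ∀ n c (f g : ℕ → ℕ) → σ (suc n) (λ w → σ (suc n) (λ w' → f w * g w' * 𝟙 (w + w' + c ≡ᵇ n))) ≡ guard c n (conv f g (n ∸ c))
  σ²-conv n c f g = begin
    σ (suc n) (λ w → σ (suc n) (λ w' → f w * g w' * 𝟙 (w + w' + c ≡ᵇ n)))
      ≡⟨ σ-cong (suc n) (λ w → σ-cong (suc n) (λ w' → trans (cong (f w * g w' *_) (𝟙-sum-guard w w' c n))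
            (*-guard (f w * g w') (w + c) n _))) ⟩
    σ (suc n) (λ w → σ (suc n) (λ w' → guard (w + c) n (f w * g w' * 𝟙 (w' ≡ᵇ n ∸ (w + c)))))
      ≡⟨ σ-cong (suc n) (λ w → trans (σ-guard-out (suc n) (w + c) n (λ w' → f w * g w' * 𝟙 (w' ≡ᵇ n ∸ (w + c)))) (cong (guard (w + c) n)
            (trans (σ-cong (suc n) (λ w' → *-assoc (f w) (g w') (𝟙 (w' ≡ᵇ n ∸ (w + c))))) (trans (σ-*ˡ (suc n) (f w) (λ w' → g w' * 𝟙 (w' ≡ᵇ n ∸ (w + c)))) (cong (f w *_) (σ-pick n (n ∸ (w + c)) g)))))) ⟩
    σ (suc n) (λ w → guard (w + c) n (f w * guard (n ∸ (w + c)) n (g (n ∸ (w + c)))))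
      ≡⟨ σ-cong (suc n) (λ w → trans (cong (λ z → guard (w + c) n (f w * z)) (guard-≤ (n ∸ (w + c)) n _ (m∸n≤m n (w + c))))
            (trans (cong (λ z → guard z n (f w * g (n ∸ (w + c)))) (+-comm w c)) (guard-shift c w n _))) ⟩
    σ (suc n) (λ w → guard c n (guard w (n ∸ c) (f w * g (n ∸ (w + c)))))
      ≡⟨ σ-guard-out (suc n) c n (λ w → guard w (n ∸ c) (f w * g (n ∸ (w + c)))) ⟩
    guard c n (σ (suc n) (λ w → guard w (n ∸ c) (f w * g (n ∸ (w + c)))))
      ≡⟨ cong (guard c n) (σ-guard-extend (n ∸ c) n (λ w → f w * g (n ∸ (w + c))) (m∸n≤m n c)) ⟩
    guard c n (σ (suc (n ∸ c)) (λ w → f w * g (n ∸ (w + c))))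
      ≡⟨ cong (guard c n) (σ-cong (suc (n ∸ c)) (λ w → cong (λ z → f w * g z) (trans (cong (n ∸_) (+-comm w c)) (sym (∸-+-assoc n c w))))) ⟩
    guard c n (conv f g (n ∸ c)) ∎
    where
    *-guard : ∀ a c x v → a * guard c x v ≡ guard c x (a * v)
    *-guard a zero    x       v = refl
    *-guard a (suc c) zero    v = *-zeroʳ a
    *-guard a (suc c) (suc x) v = *-guard a c x v

  durfeeWeight : ℕ → ℕ
  durfeeWeight D = 2 * D * D + 2 * D + 1

  rankIs : ℕ → ℕ → ℤ → Bool
  rankIs s t m = does ((+ s) ℤ.- (+ t) ℤ.≟ m)

  symbolCount : ℕ → ℕ → ℕ → ℕ → ℕ
  symbolCount n D s t = Σl (listsOfLength s (applyUpTo suc n)) (λ a → Σl (listsOfLength t (applyUpTo suc n)) (λ b →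
                rowInd (2 * D + 1) a * (rowInd (2 * D + 1) b * 𝟙 (sum a + sum b + durfeeWeight D ≡ᵇ n))))

  𝟙-symbol : ∀ m n D a b → 𝟙 (does (isOddDurfee? n (mkS D a b) ×-dec (oddRank (mkS D a b) ℤ.≟ m)))
                     ≡ (rowInd (2 * D + 1) a * (rowInd (2 * D + 1) b * 𝟙 (sum a + sum b + durfeeWeight D ≡ᵇ n))) * 𝟙 (rankIs (length a) (length b) m)
  𝟙-symbol m n D a b = begin
    𝟙 ((va ∧ (vb ∧ e)) ∧ rankIs (length a) (length b) m)
      ≡⟨ 𝟙-∧ (va ∧ (vb ∧ e)) _ ⟩
    𝟙 (va ∧ (vb ∧ e)) * 𝟙 (rankIs (length a) (length b) m)
      ≡⟨ cong (_* 𝟙 (rankIs (length a) (length b) m)) (trans (𝟙-∧ va _) (cong₂ _*_ (validRow?-𝟙 D a) (trans (𝟙-∧ vb e) (cong (_* 𝟙 e) (validRow?-𝟙 D b))))) ⟩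
    (rowInd (2 * D + 1) a * (rowInd (2 * D + 1) b * 𝟙 e)) * 𝟙 (rankIs (length a) (length b) m) ∎
    where
    va = does (validRow? D a)
    vb = does (validRow? D b)
    e = sum a + sum b + durfeeWeight D ≡ᵇ n

  Σl-listsUpTo : ∀ n (g : List ℕ → ℕ) → Σl (listsUpTo n (applyUpTo suc n)) g ≡ σ (suc n) (λ s → Σl (listsOfLength s (applyUpTo suc n)) g)
  Σl-listsUpTo n g = trans (Σl-concatMap (λ k → listsOfLength k (applyUpTo suc n)) (upTo (suc n)) g) (Σl-applyUpTo (λ i → i) (suc n) _)

  symbols-fixed-D : ∀ m n D → Σl (concatMap (λ a → map (mkS D a) (listsUpTo n (applyUpTo suc n))) (listsUpTo n (applyUpTo suc n)))
                                   (λ S → 𝟙 (does (isOddDurfee? n S ×-dec (oddRank S ℤ.≟ m))))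
                              ≡ σ (suc n) (λ s → σ (suc n) (λ t → 𝟙 (rankIs s t m) * symbolCount n D s t))
  symbols-fixed-D m n D = begin
    Σl (concatMap (λ a → map (mkS D a) R) R) f
      ≡⟨ Σl-concatMap (λ a → map (mkS D a) R) R f ⟩
    Σl R (λ a → Σl (map (mkS D a) R) f)
      ≡⟨ Σl-cong R (λ a → trans (Σl-map (mkS D a) R f) (Σl-cong R (λ b → 𝟙-symbol m n D a b))) ⟩
    Σl R (λ a → Σl R (λ b → X a b * 𝟙 (rankIs (length a) (length b) m)))
      ≡⟨ trans (Σl-listsUpTo n (λ a → Σl R (λ b → X a b * 𝟙 (rankIs (length a) (length b) m))))
               (σ-cong (suc n) (λ s → Σl-cong (rows s) (λ a → Σl-listsUpTo n (λ b → X a b * 𝟙 (rankIs (length a) (length b) m))))) ⟩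
    σ (suc n) (λ s → Σl (rows s) (λ a → σ (suc n) (λ t → Σl (rows t) (λ b → X a b * 𝟙 (rankIs (length a) (length b) m)))))
      ≡⟨ σ-cong (suc n) (λ s → trans (Σl-cong (rows s) (λ a → σ-cong (suc n) (λ t →
             Σl-listsOfLength t vs (λ b lb → X a b * 𝟙 (rankIs (length a) lb m)))))
             (Σl-listsOfLength s vs (λ a la → σ (suc n) (λ t → Σl (rows t) (λ b → X a b * 𝟙 (rankIs la t m)))))) ⟩
    σ (suc n) (λ s → Σl (rows s) (λ a → σ (suc n) (λ t → Σl (rows t) (λ b → X a b * 𝟙 (rankIs s t m)))))
      ≡⟨ σ-cong (suc n) (λ s → Σl-σ (rows s) (suc n) (λ a t → Σl (rows t) (λ b → X a b * 𝟙 (rankIs s t m)))) ⟩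
    σ (suc n) (λ s → σ (suc n) (λ t → Σl (rows s) (λ a → Σl (rows t) (λ b → X a b * 𝟙 (rankIs s t m)))))
      ≡⟨ σ-cong (suc n) (λ s → σ-cong (suc n) (λ t → trans (Σl-cong (rows s) (λ a → Σl-*ʳ (rows t) (𝟙 (rankIs s t m)) (X a)))
             (trans (Σl-*ʳ (rows s) (𝟙 (rankIs s t m)) (λ a → Σl (rows t) (X a))) (*-comm (symbolCount n D s t) (𝟙 (rankIs s t m)))))) ⟩
    σ (suc n) (λ s → σ (suc n) (λ t → 𝟙 (rankIs s t m) * symbolCount n D s t)) ∎
    where
    vs = applyUpTo suc n
    R = listsUpTo n vs
    rows : ℕ → List (List ℕ)
    rows s = listsOfLength s vs
    f : Symbol → ℕ
    f S = 𝟙 (does (isOddDurfee? n S ×-dec (oddRank S ℤ.≟ m)))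
    X : List ℕ → List ℕ → ℕ
    X a b = rowInd (2 * D + 1) a * (rowInd (2 * D + 1) b * 𝟙 (sum a + sum b + durfeeWeight D ≡ᵇ n))

  D⁰₁-symbolCount : ∀ m n → D⁰₁ m n ≡ σ (suc n) (λ D → σ (suc n) (λ s → σ (suc n) (λ t → 𝟙 (rankIs s t m) * symbolCount n D s t)))
  D⁰₁-symbolCount m n = begin
    length (filter P? (candidates n))
      ≡⟨ length-filter P? (candidates n) ⟩
    Σl (concatMap (λ D → concatMap (λ a → map (mkS D a) R) R) (upTo (suc n))) f
      ≡⟨ Σl-concatMap (λ D → concatMap (λ a → map (mkS D a) R) R) (upTo (suc n)) f ⟩
    Σl (upTo (suc n)) (λ D → Σl (concatMap (λ a → map (mkS D a) R) R) f)
      ≡⟨ Σl-applyUpTo (λ i → i) (suc n) _ ⟩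
    σ (suc n) (λ D → Σl (concatMap (λ a → map (mkS D a) R) R) f)
      ≡⟨ σ-cong (suc n) (symbols-fixed-D m n) ⟩
    σ (suc n) (λ D → σ (suc n) (λ s → σ (suc n) (λ t → 𝟙 (rankIs s t m) * symbolCount n D s t))) ∎
    where
    R = listsUpTo n (applyUpTo suc n)
    P? = λ S → isOddDurfee? n S ×-dec (oddRank S ℤ.≟ m)
    f : Symbol → ℕ
    f S = 𝟙 (does (P? S))

  symbolSeries : ℕ → ℕ → ℕ → ℕ → ℕ
  symbolSeries n D s t = guard (durfeeWeight D) n (conv (shift s (gauss D s)) (shift t (gauss D t)) (n ∸ durfeeWeight D))

  symbolCount-conv : ∀ n D s t → symbolCount n D s t ≡ symbolSeries n D s t
  symbolCount-conv n D s t = begin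
    symbolCount n D s t
      ≡⟨ Σl-cong La (λ a → Σl-cong Lb (λ b → cong (λ z → rowInd B a * (rowInd B b * z)) (𝟙-sum-split (sum a) (sum b) (durfeeWeight D) n))) ⟩
    Σl La (λ a → Σl Lb (λ b → rowInd B a * (rowInd B b * σ (suc n) (λ w → 𝟙 (sum a ≡ᵇ w) * σ (suc n) (λ w' → 𝟙 (sum b ≡ᵇ w') * 𝟙 (w + w' + durfeeWeight D ≡ᵇ n))))))
      ≡⟨ Σl-σ² La Lb (rowInd B) (rowInd B) sum sum (suc n) (λ w w' → 𝟙 (w + w' + durfeeWeight D ≡ᵇ n)) ⟩
    σ (suc n) (λ w → σ (suc n) (λ w' → rowSeries n B s w * rowSeries n B t w' * 𝟙 (w + w' + durfeeWeight D ≡ᵇ n)))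
      ≡⟨ σ²-conv n (durfeeWeight D) (rowSeries n B s) (rowSeries n B t) ⟩
    guard (durfeeWeight D) n (conv (rowSeries n B s) (rowSeries n B t) (n ∸ durfeeWeight D))
      ≡⟨ cong (guard (durfeeWeight D) n) (conv-cong≤ (n ∸ durfeeWeight D) _ _ _ _
            (λ i p → rowSeries-gauss n s D i (≤-trans p (m∸n≤m n (durfeeWeight D))))
            (λ i p → rowSeries-gauss n t D i (≤-trans p (m∸n≤m n (durfeeWeight D))))) ⟩
    symbolSeries n D s t ∎
    where
    B = 2 * D + 1
    La = listsOfLength s (applyUpTo suc n)
    Lb = listsOfLength t (applyUpTo suc n)

  D⁰₁-expand : ∀ m n → D⁰₁ m n ≡ σ (suc n) (λ D → σ (suc n) (λ s → σ (suc n) (λ t → 𝟙 (rankIs s t m) * symbolSeries n D s t)))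
  D⁰₁-expand m n = trans (D⁰₁-symbolCount m n) (σ-cong (suc n) (λ D → σ-cong (suc n) (λ s → σ-cong (suc n) (λ t → cong (𝟙 (rankIs s t m) *_) (symbolCount-conv n D s t)))))

  difference : ∀ s t → (Σ ℕ λ x → (s ≡ t + x) × ((+ s) ℤ.- (+ t) ≡ + x)) ⊎ (Σ ℕ λ d → (t ≡ suc s + d) × ((+ s) ℤ.- (+ t) ≡ -[1+ d ]))
  difference s t with split t s
  ... | ge x refl = inj₁ (x , refl , trans (ℤP.m-n≡m⊖n (t + x) t) (trans (ℤP.⊖-≥ (m≤m+n t x)) (cong +_ (m+n∸m≡n t x))))
  ... | lt p with split (suc s) t
  ...   | lt q = ⊥-elim (<⇒≱ q p)
  ...   | ge d refl = inj₂ (d , refl , trans (ℤP.m-n≡m⊖n s (suc s + d)) (trans (ℤP.⊖-< (m≤m+n (suc s) d))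
                          (cong (λ z → ℤ.- (+ z)) (trans (cong (_∸ s) (sym (+-suc s d))) (m+n∸m≡n s (suc d))))))

  rankIs-pos : ∀ s t M → rankIs s t (+ M) ≡ (s ≡ᵇ t + M)
  rankIs-pos s t M with difference s t
  ... | inj₁ (x , refl , e) = trans (cong (λ z → does (z ℤ.≟ + M)) e) (sym (≡ᵇ-cancel t x M))
  ... | inj₂ (d , refl , e) = trans (cong (λ z → does (z ℤ.≟ + M)) e) (sym (≡ᵇ-false (λ q → <⇒≱ (≤-trans (s≤s (m≤m+n s d)) (m≤m+n (suc s + d) M)) (≤-reflexive (sym q)))))

  rankIs-neg : ∀ s t k → rankIs s t -[1+ k ] ≡ (t ≡ᵇ s + suc k)
  rankIs-neg s t k with difference s t
  ... | inj₁ (x , refl , e) = trans (cong (λ z → does (z ℤ.≟ -[1+ k ])) e) (sym (≡ᵇ-false (λ q → <⇒≱ (subst (_< t + x + suc k) (+-identityʳ t)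
            (+-mono-≤-< (m≤m+n t x) (s≤s z≤n))) (≤-reflexive (sym q)))))
  ... | inj₂ (d , refl , e) = trans (cong (λ z → does (z ℤ.≟ -[1+ k ])) e)
            (trans (sym (≡ᵇ-cancel (suc s) d k)) (cong (λ z → suc s + d ≡ᵇ z) (sym (+-suc s k))))

  symbolSeries-sym : ∀ n D s t → symbolSeries n D s t ≡ symbolSeries n D t s
  symbolSeries-sym n D s t = cong (guard (durfeeWeight D) n) (conv-comm (shift s (gauss D s)) (shift t (gauss D t)) (n ∸ durfeeWeight D))

  D⁰₁-pos : ∀ M n → D⁰₁ (+ M) n ≡ σ (suc n) (λ D → σ (suc n) (λ t → guard (t + M) n (symbolSeries n D (t + M) t)))
  D⁰₁-pos M n = trans (D⁰₁-expand (+ M) n) (σ-cong (suc n) (λ D → begin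
    σ (suc n) (λ s → σ (suc n) (λ t → 𝟙 (rankIs s t (+ M)) * symbolSeries n D s t))
      ≡⟨ σ-swap (suc n) (suc n) (λ s t → 𝟙 (rankIs s t (+ M)) * symbolSeries n D s t) ⟩
    σ (suc n) (λ t → σ (suc n) (λ s → 𝟙 (rankIs s t (+ M)) * symbolSeries n D s t))
      ≡⟨ σ-cong (suc n) (λ t → trans (σ-cong (suc n) (λ s → cong (λ b → 𝟙 b * symbolSeries n D s t) (trans (rankIs-pos s t M) (≡ᵇ-sym s (t + M)))))
                                       (σ-pick′ n (t + M) (λ s → symbolSeries n D s t))) ⟩
    σ (suc n) (λ t → guard (t + M) n (symbolSeries n D (t + M) t)) ∎))

  -- exchanging the two rows: rank -(k+1) and rank k+1 are equinumerous
  D⁰₁-neg : ∀ k n → D⁰₁ -[1+ k ] n ≡ D⁰₁ (+ suc k) n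
  D⁰₁-neg k n = trans (D⁰₁-expand -[1+ k ] n) (trans (σ-cong (suc n) (λ D →
    trans (σ-cong (suc n) (λ s → trans (σ-cong (suc n) (λ t → cong (λ b → 𝟙 b * symbolSeries n D s t) (trans (rankIs-neg s t k) (≡ᵇ-sym t (s + suc k)))))
                                        (σ-pick′ n (s + suc k) (λ t → symbolSeries n D s t))))
          (σ-cong (suc n) (λ s → cong (guard (s + suc k) n) (symbolSeries-sym n D s (s + suc k)))))) (sym (D⁰₁-pos (suc k) n)))

  private
    weight-split : ∀ D M t → 2 * D * D + 2 * D + 1 + (t + M + t) ≡ suc M + (2 * (D * suc D) + 2 * t)
    weight-split = solve-∀

  symbolSeries-durfeeTerm : ∀ n D M t → symbolSeries n D (t + M) t ≡ shift (suc M) (durfeeTerm M D t) n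
  symbolSeries-durfeeTerm n D M t = begin
    guard (durfeeWeight D) n (conv (shift (t + M) A1) (shift t A2) (n ∸ durfeeWeight D))
      ≡⟨ cong (guard (durfeeWeight D) n) (conv-shift² (t + M) t A1 A2 (n ∸ durfeeWeight D)) ⟩
    guard (durfeeWeight D) n (shift (t + M + t) (conv A1 A2) (n ∸ durfeeWeight D))
      ≡⟨ guard-as-shift (durfeeWeight D) n _ ⟩
    shift (durfeeWeight D) (shift (t + M + t) (conv A1 A2)) n
      ≡⟨ shift-shift≡ (durfeeWeight D) (t + M + t) _ (conv A1 A2) n (weight-split D M t) ⟩
    shift (suc M + (2 * (D * suc D) + 2 * t)) (conv A1 A2) n
      ≡⟨ sym (shift-shift (suc M) _ _ n) ⟩
    shift (suc M) (shift (2 * (D * suc D) + 2 * t) (conv A1 A2)) n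
      ≡⟨ sym (shift-cong (suc M) (λ x → trans (shift-cong (2 * (D * suc D)) (conv-shiftʳ (2 * t) A1 A2) x) (shift-shift (2 * (D * suc D)) (2 * t) _ x)) n) ⟩
    shift (suc M) (durfeeTerm M D t) n ∎
    where
    A1 = gauss D (t + M)
    A2 = gauss D t

  private
    N<M+N : ∀ M N → suc N ≤ suc (suc M + N)
    N<M+N M N = s≤s (≤-trans (m≤n+m N M) (n≤1+n (M + N)))

  -- at q^(M+1+N) only rows with t ≤ N contribute, and for them t + M ≤ M+1+N holds
  durfeeTerms-guarded : ∀ M N D → σ (suc (suc M + N)) (λ t → guard (t + M) (suc M + N) (durfeeTerm M D t N)) ≡ σ (suc N) (λ t → durfeeTerm M D t N)
  durfeeTerms-guarded M N D = trans
    (σ-truncate (suc N) (suc (suc M + N)) _ (N<M+N M N)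
       (λ t q → trans (cong (guard (t + M) (suc M + N)) (durfeeTerm-vanish M D t N (≤-trans q (m≤n+m t D)))) (guard-0 (t + M) (suc M + N))))
    (σ-cong< (suc N) {g = λ t → durfeeTerm M D t N}
       (λ t q → guard-≤ (t + M) (suc M + N) _ (≤-trans (+-monoˡ-≤ M (≤-pred q)) (≤-trans (≤-reflexive (+-comm N M)) (n≤1+n (M + N))))))

  durfeeSeries-guarded : ∀ M n → σ (suc n) (λ D → σ (suc n) (λ t → guard (t + M) n (shift (suc M) (durfeeTerm M D t) n)))
                               ≡ shift (suc M) (durfeeSeries M) n
  durfeeSeries-guarded M n with split (suc M) n
  ... | lt p = trans (σ-zero (suc n) (λ D _ → σ-zero (suc n) (λ t _ →
                 trans (cong (guard (t + M) n) (shift-< (suc M) (durfeeTerm M D t) n p)) (guard-0 (t + M) n))))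
               (sym (shift-< (suc M) _ n p))
  ... | ge N refl = begin
    σ (suc n) (λ D → σ (suc n) (λ t → guard (t + M) n (shift (suc M) (durfeeTerm M D t) (suc M + N))))
      ≡⟨ σ-cong (suc n) (λ D → σ-cong (suc n) (λ t → cong (guard (t + M) n) (shift-+ (suc M) (durfeeTerm M D t) N))) ⟩
    σ (suc n) (λ D → σ (suc n) (λ t → guard (t + M) n (durfeeTerm M D t N)))
      ≡⟨ σ-cong (suc n) (durfeeTerms-guarded M N) ⟩
    σ (suc n) (λ D → σ (suc N) (λ t → durfeeTerm M D t N))
      ≡⟨ σ-truncate (suc N) (suc n) _ (N<M+N M N) (λ D q → σ-zero (suc N) (λ t _ → durfeeTerm-vanish M D t N (≤-trans q (m≤m+n D t)))) ⟩
    σ (suc N) (λ D → σ (suc N) (λ t → durfeeTerm M D t N))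
      ≡⟨ sym (shift-+ (suc M) (durfeeSeries M) N) ⟩
    shift (suc M) (durfeeSeries M) (suc M + N) ∎

  D⁰₁-durfeeSeries : ∀ M n → D⁰₁ (+ M) n ≡ shift (suc M) (durfeeSeries M) n
  D⁰₁-durfeeSeries M n = begin
    D⁰₁ (+ M) n
      ≡⟨ D⁰₁-pos M n ⟩
    σ (suc n) (λ D → σ (suc n) (λ t → guard (t + M) n (symbolSeries n D (t + M) t)))
      ≡⟨ σ-cong (suc n) (λ D → σ-cong (suc n) (λ t → cong (guard (t + M) n) (symbolSeries-durfeeTerm n D M t))) ⟩
    σ (suc n) (λ D → σ (suc n) (λ t → guard (t + M) n (shift (suc M) (durfeeTerm M D t) n)))
      ≡⟨ durfeeSeries-guarded M n ⟩
    shift (suc M) (durfeeSeries M) n ∎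

-- The ℤ-valued series of the statement are written as
-- differences of ℕ-valued ones: 1/(q²;q²)_∞ is `partitions` (the truncated
-- product is identified with gauss by uniqueness of solutions of
-- Φ = f + q^d Φ), and the theta series splits according to the parity of k
-- into theta evenInd - theta oddInd, each satisfying a shift recursion.
module RightHandSide where

  open PowerSeries
  open Gaussian
  open PartitionIdentities
  open ListSums
  open Data.Integer using (+_; -[1+_])

  private
    split-difference : ∀ x y z w → (x ℤ.- y) ℤ.+ (z ℤ.- w) ≡ (x ℤ.+ z) ℤ.- (y ℤ.+ w)
    split-difference = ZR.solve-∀

  sumℤ-difference : ∀ k (g : ℕ → ℕ) (f : ℕ → ℤ) (a b : ℕ → ℕ) → (∀ i → f (g i) ≡ + a i ℤ.- + b i) →
         sumℤ (map f (applyUpTo g k)) ≡ + σ k a ℤ.- + σ k b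
  sumℤ-difference zero g f a b e = refl
  sumℤ-difference (suc k) g f a b e = begin
    f (g 0) ℤ.+ sumℤ (map f (applyUpTo (λ i → g (suc i)) k))
      ≡⟨ cong₂ ℤ._+_ (e 0) (sumℤ-difference k (λ i → g (suc i)) f (λ i → a (suc i)) (λ i → b (suc i)) (λ i → e (suc i))) ⟩
    (+ a 0 ℤ.- + b 0) ℤ.+ (+ σ k (λ i → a (suc i)) ℤ.- + σ k (λ i → b (suc i)))
      ≡⟨ split-difference (+ a 0) (+ b 0) (+ σ k (λ i → a (suc i))) (+ σ k (λ i → b (suc i))) ⟩
    (+ a 0 ℤ.+ + σ k (λ i → a (suc i))) ℤ.- (+ b 0 ℤ.+ + σ k (λ i → b (suc i)))
      ≡⟨ sym (cong₂ ℤ._-_ (ℤP.pos-+ (a 0) _) (ℤP.pos-+ (b 0) _)) ⟩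
    + σ (suc k) a ℤ.- + σ (suc k) b ∎

  sumℤ-pos : ∀ k (g : ℕ → ℕ) (f : ℕ → ℤ) (a : ℕ → ℕ) → (∀ i → f (g i) ≡ + a i) → sumℤ (map f (applyUpTo g k)) ≡ + σ k a
  sumℤ-pos zero g f a e = refl
  sumℤ-pos (suc k) g f a e = trans (cong₂ ℤ._+_ (e 0) (sumℤ-pos k (λ i → g (suc i)) f (λ i → a (suc i)) (λ i → e (suc i)))) (sym (ℤP.pos-+ (a 0) _))

  -- 1/(1 - q^(d+1)) with natural coefficients
  geomℕ : ℕ → ℕ → ℕ
  geomℕ d n = 𝟙 (n % suc d ≡ᵇ 0)

  if-𝟙 : ∀ b → (if b then 1ℤ else 0ℤ) ≡ + 𝟙 b
  if-𝟙 true = refl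
  if-𝟙 false = refl

  geomℕ-rec : ∀ d n → geomℕ d n ≡ δ n + shift (suc d) (geomℕ d) n
  geomℕ-rec d n with split (suc d) n
  ... | lt p with n
  ...   | zero = refl
  ...   | suc n' = trans (cong (λ z → 𝟙 (z ≡ᵇ 0)) (m<n⇒m%n≡m p)) (sym (shift-< (suc d) _ (suc n') p))
  geomℕ-rec d n | ge n' refl = trans (cong (λ z → 𝟙 (z ≡ᵇ 0)) (trans (cong (_% suc d) (+-comm (suc d) n')) ([m+n]%n≡m%n n' (suc d))))
                                   (sym (shift-+ (suc d) (geomℕ d) n'))

  fixpoint-unique : ∀ d (f Φ₁ Φ₂ : Series) → (∀ n → Φ₁ n ≡ f n + shift (suc d) Φ₁ n) → (∀ n → Φ₂ n ≡ f n + shift (suc d) Φ₂ n) → ∀ N n → n ≤ N → Φ₁ n ≡ Φ₂ n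
  fixpoint-unique d f Φ₁ Φ₂ e₁ e₂ N n le = trans (e₁ n) (trans (cong (λ z → f n + z) (shift-cong-at (suc d) Φ₁ Φ₂ n (step N le))) (sym (e₂ n)))
    where
    step : ∀ N → n ≤ N → suc d ≤ n → Φ₁ (n ∸ suc d) ≡ Φ₂ (n ∸ suc d)
    step zero z≤n ()
    step (suc N') le q = fixpoint-unique d f Φ₁ Φ₂ e₁ e₂ N' (n ∸ suc d) (≤-trans (∸-monoʳ-≤ n (s≤s (z≤n {d}))) (∸-monoˡ-≤ 1 le))

  -- The coefficient of qⁿ in ∏_{i=1}^{j} 1/(1 - q^(2i)) is gauss j n n (at qⁿ the
  -- bound n on the number of parts is no restriction).  Induction on j: both
  -- (∏_{i ≤ j} ⋯)·1/(1 - q^(2(j+1))) and n ↦ gauss (j+1) n n solve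
  -- Φ = f + q^(2(j+1)) Φ with f n = gauss j n n, the latter by gauss-conjugate.
  invPochTrunc-gauss : ∀ j n → invPochTrunc j n ≡ + gauss j n n
  invPochTrunc-gauss zero zero = refl
  invPochTrunc-gauss zero (suc n) = refl
  invPochTrunc-gauss (suc j) n = begin
    sumℤ (map (λ i → invPochTrunc j i ℤ.* geomPS (2 * suc j) (n ∸ i)) (upTo (suc n)))
      ≡⟨ sumℤ-pos (suc n) (λ i → i) _ (λ i → gauss j i i * geomℕ d' (n ∸ i))
           (λ i → trans (cong₂ ℤ._*_ (invPochTrunc-gauss j i) (if-𝟙 _)) (sym (ℤP.pos-* (gauss j i i) _))) ⟩
    + conv (λ i → gauss j i i) (geomℕ d') n
      ≡⟨ cong +_ (fixpoint-unique d' f Φ₁ Φ₂ e₁ e₂ n n ≤-refl) ⟩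
    + gauss (suc j) n n ∎
    where
    d' = j + 1 * suc j
    f : Series
    f i = gauss j i i
    Φ₁ : Series
    Φ₁ = conv f (geomℕ d')
    Φ₂ : Series
    Φ₂ x = gauss (suc j) x x
    e₁ : ∀ x → Φ₁ x ≡ f x + shift (suc d') Φ₁ x
    e₁ x = trans (conv-cong {f = f} {f' = f} (λ _ → refl) (geomℕ-rec d') x)
           (trans (conv-⊕ʳ δ (shift (suc d') (geomℕ d')) f x) (cong₂ _+_ (conv-δʳ f x) (conv-shiftʳ (suc d') f (geomℕ d') x)))
    e₂ : ∀ x → Φ₂ x ≡ f x + shift (suc d') Φ₂ x
    e₂ zero = refl
    e₂ (suc x') = trans (gauss-conjugate j x' (suc x')) (cong (λ z → gauss j (suc x') (suc x') + z)
                    (shift-cong-at (suc d') (gauss (suc j) x') Φ₂ (suc x') (λ q → gauss-stable (suc j) x' (suc x' ∸ suc d') (∸-monoʳ-≤ {1} {suc d'} (suc x') (s≤s z≤n)))))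

  -- 1/(q²;q²)_∞ = partitions: at qⁿ the factors beyond j = n do not matter
  invPoch-partitions : ∀ n → invPoch n ≡ + partitions n
  invPoch-partitions n = trans (invPochTrunc-gauss n n) (cong +_ (sym (gauss-stableᴰ n n n (n≤2*n (suc n)))))

  expoℕ : ℕ → ℕ → ℕ
  expoℕ M k = 3 * k * k + 3 * k + 1 + M * (2 * k + 1)

  -- (-1)ᵏ = evenInd k - oddInd k
  evenInd oddInd : ℕ → ℕ
  evenInd zero = 1
  evenInd (suc k) = oddInd k
  oddInd zero = 0
  oddInd (suc k) = evenInd k

  private
    negate-difference : ∀ x y → -1ℤ ℤ.* (x ℤ.- y) ≡ y ℤ.- x
    negate-difference = ZR.solve-∀

  -1^-parity : ∀ k → -1ℤ ℤ.^ k ≡ + evenInd k ℤ.- + oddInd k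
  -1^-parity zero = refl
  -1^-parity (suc k) = trans (cong (-1ℤ ℤ.*_) (-1^-parity k)) (negate-difference (+ evenInd k) (+ oddInd k))

  theta : (ℕ → ℕ) → ℕ → Series
  theta p M n = σ (suc n) (λ k → 𝟙 (expoℕ M k ≡ᵇ n) * p k)

  theta-bridge : ∀ m n → thetaPS m n ≡ + (theta evenInd (∣ m ∣) n) ℤ.- + (theta oddInd (∣ m ∣) n)
  theta-bridge m n = sumℤ-difference (suc n) (λ i → i) _ (λ k → 𝟙 (expoℕ (∣ m ∣) k ≡ᵇ n) * evenInd k) (λ k → 𝟙 (expoℕ (∣ m ∣) k ≡ᵇ n) * oddInd k) e
    where
    e : ∀ k → (if (expoℕ (∣ m ∣) k ≡ᵇ n) then -1ℤ ℤ.^ k else 0ℤ) ≡ + (𝟙 (expoℕ (∣ m ∣) k ≡ᵇ n) * evenInd k) ℤ.- + (𝟙 (expoℕ (∣ m ∣) k ≡ᵇ n) * oddInd k)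
    e k with expoℕ (∣ m ∣) k ≡ᵇ n
    ... | true = trans (-1^-parity k) (sym (cong₂ (λ a b → + a ℤ.- + b) (+-identityʳ (evenInd k)) (+-identityʳ (oddInd k))))
    ... | false = refl

  private
    expoℕ-suc : ∀ M k → 3 * (1 + k) * (1 + k) + 3 * (1 + k) + 1 + M * (2 * (1 + k) + 1)
                      ≡ (2 * M + 3) + (3 * k * k + 3 * k + 1 + (M + 3) * (2 * k + 1))
    expoℕ-suc = solve-∀
    expoℕ-zero : ∀ M → 3 * 0 * 0 + 3 * 0 + 1 + M * (2 * 0 + 1) ≡ 1 + M
    expoℕ-zero = solve-∀

  -- the exponent of the k-th term is at least k, so k ≤ n suffices at qⁿ
  expoℕ-≥ : ∀ M k → k ≤ expoℕ M k
  expoℕ-≥ M k = ≤-trans (m≤n*m k 3) (≤-trans (m≤n+m (3 * k) (3 * k * k)) (≤-trans (m≤m+n _ 1) (m≤m+n _ (M * (2 * k + 1)))))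

  𝟙-shift-δ : ∀ c n → 𝟙 (c ≡ᵇ n) ≡ shift c δ n
  𝟙-shift-δ zero zero = refl
  𝟙-shift-δ zero (suc n) = refl
  𝟙-shift-δ (suc c) zero = refl
  𝟙-shift-δ (suc c) (suc n) = 𝟙-shift-δ c n

  -- expoℕ M (k+1) = 2M + 3 + expoℕ (M+3) k: the theta series of M is its first
  -- term plus q^(2M+3) times the theta series of M+3 with shifted coefficients
  theta-step : ∀ p M n → theta p M n ≡ 𝟙 (expoℕ M 0 ≡ᵇ n) * p 0 + shift (2 * M + 3) (theta (λ k → p (suc k)) (M + 3)) n
  theta-step p M n = cong (λ z → 𝟙 (expoℕ M 0 ≡ᵇ n) * p 0 + z) rest
    where
    c = 2 * M + 3
    q = λ k → p (suc k)
    rest : σ n (λ k → 𝟙 (expoℕ M (suc k) ≡ᵇ n) * p (suc k)) ≡ shift c (theta q (M + 3)) n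
    rest with split c n
    ... | lt lp = trans (σ-zero n (λ k _ → trans (cong (λ z → 𝟙 (z ≡ᵇ n) * q k) (expoℕ-suc M k)) (cong (λ b → 𝟙 b * q k) (≡ᵇ-false-< c (expoℕ (M + 3) k) n lp))))
                        (sym (shift-< c _ n lp))
    ... | ge x refl = begin
      σ (c + x) (λ k → 𝟙 (expoℕ M (suc k) ≡ᵇ c + x) * q k)
        ≡⟨ σ-cong (c + x) (λ k → trans (cong (λ z → 𝟙 (z ≡ᵇ c + x) * q k) (expoℕ-suc M k)) (cong (λ b → 𝟙 b * q k) (≡ᵇ-cancel c (expoℕ (M + 3) k) x))) ⟩
      σ (c + x) (λ k → 𝟙 (expoℕ (M + 3) k ≡ᵇ x) * q k)
        ≡⟨ σ-truncate (suc x) (c + x) _ (subst (suc x ≤_) (+-comm x c) (≤-trans (≤-reflexive (+-comm 1 x)) (+-monoʳ-≤ x (≤-trans (s≤s z≤n) (m≤n+m 3 (2 * M))))))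
             (λ k r → cong (λ b → 𝟙 b * q k) (≡ᵇ-false {expoℕ (M + 3) k} {x} (λ e → <⇒≱ (≤-trans r (expoℕ-≥ (M + 3) k)) (≤-reflexive e)))) ⟩
      theta q (M + 3) x
        ≡⟨ sym (shift-+ c (theta q (M + 3)) x) ⟩
      shift c (theta q (M + 3)) (c + x) ∎

  theta-even : ∀ M n → theta evenInd M n ≡ shift (suc M) δ n + shift (2 * M + 3) (theta oddInd (M + 3)) n
  theta-even M n = trans (theta-step evenInd M n) (cong (λ z → z + shift (2 * M + 3) (theta oddInd (M + 3)) n) (trans (*-identityʳ _) (trans (cong (λ z → 𝟙 (z ≡ᵇ n)) (expoℕ-zero M)) (𝟙-shift-δ (suc M) n))))

  theta-odd : ∀ M n → theta oddInd M n ≡ shift (2 * M + 3) (theta evenInd (M + 3)) n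
  theta-odd M n = trans (theta-step oddInd M n) (cong (λ z → z + shift (2 * M + 3) (theta evenInd (M + 3)) n) (*-zeroʳ (𝟙 (expoℕ M 0 ≡ᵇ n))))

-- With L_M = Σₙ 𝒟⁰₁(M;n)qⁿ and P = 1/(q²;q²)_∞,
--   L_M + q^(2M+3) L_(M+3) = q^(M+1) P,
-- while R⁺_M = P·theta evenInd M and R⁻_M = P·theta oddInd M satisfy
--   R⁺_M = q^(M+1) P + q^(2M+3) R⁻_(M+3),   R⁻_M = q^(2M+3) R⁺_(M+3).
-- Hence L_M + R⁻_M = R⁺_M, coefficientwise by induction on the exponent.
module Telescoping where

  open PowerSeries
  open PartitionIdentities
  open SymbolCounting
  open RightHandSide
  open Data.Integer using (+_; -[1+_])

  private
    *-distrib-difference : ∀ x y z → x ℤ.* (y ℤ.- z) ≡ x ℤ.* y ℤ.- x ℤ.* z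
    *-distrib-difference = ZR.solve-∀

  rhsEven rhsOdd : ℕ → Series
  rhsEven M = conv partitions (theta evenInd M)
  rhsOdd M = conv partitions (theta oddInd M)

  conv-bridge : ∀ m n → (invPoch ⋆ thetaPS m) n ≡ + (rhsEven (∣ m ∣) n) ℤ.- + (rhsOdd (∣ m ∣) n)
  conv-bridge m n = sumℤ-difference (suc n) (λ i → i) _ (λ i → partitions i * theta evenInd (∣ m ∣) (n ∸ i)) (λ i → partitions i * theta oddInd (∣ m ∣) (n ∸ i))
    (λ i → trans (cong₂ ℤ._*_ (invPoch-partitions i) (theta-bridge m (n ∸ i)))
           (trans (*-distrib-difference (+ partitions i) _ _) (sym (cong₂ ℤ._-_ (ℤP.pos-* (partitions i) _) (ℤP.pos-* (partitions i) _)))))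

  rhsEven-step : ∀ M n → rhsEven M n ≡ shift (suc M) partitions n + shift (2 * M + 3) (rhsOdd (M + 3)) n
  rhsEven-step M n = begin
    conv partitions (theta evenInd M) n
      ≡⟨ conv-cong {f = partitions} {f' = partitions} (λ _ → refl) (theta-even M) n ⟩
    conv partitions (shift (suc M) δ ⊕ shift (2 * M + 3) (theta oddInd (M + 3))) n
      ≡⟨ conv-⊕ʳ (shift (suc M) δ) (shift (2 * M + 3) (theta oddInd (M + 3))) partitions n ⟩
    conv partitions (shift (suc M) δ) n + conv partitions (shift (2 * M + 3) (theta oddInd (M + 3))) n
      ≡⟨ cong₂ _+_ (trans (conv-shiftʳ (suc M) partitions δ n) (shift-cong (suc M) (conv-δʳ partitions) n)) (conv-shiftʳ (2 * M + 3) partitions (theta oddInd (M + 3)) n) ⟩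
    shift (suc M) partitions n + shift (2 * M + 3) (rhsOdd (M + 3)) n ∎

  rhsOdd-step : ∀ M n → rhsOdd M n ≡ shift (2 * M + 3) (rhsEven (M + 3)) n
  rhsOdd-step M n = trans (conv-cong {f = partitions} {f' = partitions} (λ _ → refl) (theta-odd M) n) (conv-shiftʳ (2 * M + 3) partitions (theta evenInd (M + 3)) n)

  lhs : ℕ → Series
  lhs M n = D⁰₁ (+ M) n

  private
    exponents : ∀ M → 2 * M + 3 + suc (M + 3) ≡ suc M + (2 * M + 6)
    exponents = solve-∀

  -- the two partition identities, shifted by q^(M+1)
  lhs-step : ∀ M n → lhs M n + shift (2 * M + 3) (lhs (M + 3)) n ≡ shift (suc M) partitions n
  lhs-step M n = begin
    lhs M n + shift (2 * M + 3) (lhs (M + 3)) n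
      ≡⟨ cong₂ _+_ (D⁰₁-durfeeSeries M n) (shift-cong (2 * M + 3) (D⁰₁-durfeeSeries (M + 3)) n) ⟩
    shift (suc M) (durfeeSeries M) n + shift (2 * M + 3) (shift (suc (M + 3)) (durfeeSeries (M + 3))) n
      ≡⟨ cong (λ z → shift (suc M) (durfeeSeries M) n + z) (trans (shift-shift≡ (2 * M + 3) (suc (M + 3)) _ (durfeeSeries (M + 3)) n (exponents M)) (sym (shift-shift (suc M) (2 * M + 6) _ n))) ⟩
    shift (suc M) (durfeeSeries M) n + shift (suc M) (shift (2 * M + 6) (durfeeSeries (M + 3))) n
      ≡⟨ sym (shift-⊕ (suc M) (durfeeSeries M) _ n) ⟩
    shift (suc M) (durfeeSeries M ⊕ shift (2 * M + 6) (durfeeSeries (M + 3))) n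
      ≡⟨ shift-cong (suc M) (λ x → trans (cong₂ _+_ (durfee-identity M x) (shift-cong (2 * M + 6) (durfee-identity (M + 3)) x)) (complement-identity M x)) n ⟩
    shift (suc M) partitions n ∎

  telescope : ∀ N n → n ≤ N → ∀ M → lhs M n + rhsOdd M n ≡ rhsEven M n
  telescope N n le M = sym (begin
    rhsEven M n
      ≡⟨ rhsEven-step M n ⟩
    shift (suc M) partitions n + shift c (rhsOdd (M + 3)) n
      ≡⟨ cong (_+ shift c (rhsOdd (M + 3)) n) (sym (lhs-step M n)) ⟩
    (lhs M n + shift c (lhs (M + 3)) n) + shift c (rhsOdd (M + 3)) n
      ≡⟨ +-assoc (lhs M n) _ _ ⟩
    lhs M n + (shift c (lhs (M + 3)) n + shift c (rhsOdd (M + 3)) n)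
      ≡⟨ cong (λ z → lhs M n + z) (sym (shift-⊕ c (lhs (M + 3)) (rhsOdd (M + 3)) n)) ⟩
    lhs M n + shift c (lhs (M + 3) ⊕ rhsOdd (M + 3)) n
      ≡⟨ cong (λ z → lhs M n + z) (shift-cong-at c _ (rhsEven (M + 3)) n (step N le)) ⟩
    lhs M n + shift c (rhsEven (M + 3)) n
      ≡⟨ cong (λ z → lhs M n + z) (sym (rhsOdd-step M n)) ⟩
    lhs M n + rhsOdd M n ∎)
    where
    c = 2 * M + 3
    c≥1 : 1 ≤ c
    c≥1 = ≤-trans (s≤s z≤n) (m≤n+m 3 (2 * M))
    step : ∀ N → n ≤ N → c ≤ n → lhs (M + 3) (n ∸ c) + rhsOdd (M + 3) (n ∸ c) ≡ rhsEven (M + 3) (n ∸ c)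
    step zero z≤n q = ⊥-elim (<⇒≱ (≤-trans c≥1 q) z≤n)
    step (suc N') le q = telescope N' (n ∸ c) (≤-trans (∸-monoʳ-≤ n c≥1) (∸-monoˡ-≤ 1 le)) (M + 3)

  genD-abs : ∀ m n → genD m n ≡ + lhs ∣ m ∣ n
  genD-abs (+ M)     n = refl
  genD-abs -[1+ k ] n = cong +_ (D⁰₁-neg k n)

open Telescoping
open Data.Integer using (+_)

private
  cancel-right : ∀ x y → (x ℤ.+ y) ℤ.- y ≡ x
  cancel-right = ZR.solve-∀

theorem4p2 : (m : ℤ) (n : ℕ) → genD m n ≡ (invPoch ⋆ thetaPS m) n
theorem4p2 m n = begin
  genD m n                                    ≡⟨ genD-abs m n ⟩
  + L                                         ≡⟨ sym (cancel-right (+ L) (+ R⁻)) ⟩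
  (+ L ℤ.+ + R⁻) ℤ.- + R⁻                     ≡⟨ cong (ℤ._- + R⁻) (sym (ℤP.pos-+ L R⁻)) ⟩
  + (L + R⁻) ℤ.- + R⁻                         ≡⟨ cong (λ z → + z ℤ.- + R⁻) (telescope n n ≤-refl ∣ m ∣) ⟩
  + rhsEven ∣ m ∣ n ℤ.- + R⁻                  ≡⟨ sym (conv-bridge m n) ⟩
  (invPoch ⋆ thetaPS m) n                     ∎
  where
  L R⁻ : ℕ
  L  = lhs ∣ m ∣ n
  R⁻ = rhsOdd ∣ m ∣ n
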